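{- Let $G$ be a finite connected graph with at least one edge and let $\Delta$ be a decision tree for $G$. Then the $\Delta$-activity is Tutte-descriptive, i.e. $$T_G(x,y)=\sum_{T\text{ spanning tree of }G}x^{|\mathcal J(T)|}y^{|\mathcal E(T)|},$$ where $\mathcal J(T)$ and $\mathcal E(T)$ are respectively the sets of internal $\Delta$-active and external $\Delta$-active edges of $T$.
   Context: Graphs may have loops and multiple edges; subgraphs are spanning and identified with their edge sets. $\mathrm{cc}(S)$ is the number of connected components of $S$ and $\mathrm{cycl}(S)=\mathrm{cc}(S)+|S|-|V(G)|$. The Tutte polynomial is $T_G(x,y)=\sum_{S\subseteq E(G)}(x-1)^{\mathrm{cc}(S)-\mathrm{cc}(G)}(y-1)^{\mathrm{cycl}(S)}$. An isthmus is an edge whose deletion increases the number of components; an edge that is neither a loop nor an isthmus is standard. A decision tree for $G$ is a perfect binary tree whose nodes are labelled by edges of $G$ such that along every path from the root to a leaf the labels form a permutation of $E(G)$. Given a subgraph $S$, the following procedure assigns a type to each edge: set $H=G$ and $n$ = root of $\Delta$; for $k=1,\dots,|E(G)|$, let $e_k$ be the label of $n$; if $e_k$ is standard in $H$ and $e_k\notin S$, give it type $S_e$, delete it from $H$, and move $n$ to its left child; if $e_k$ is a loop in $H$, give it type $L$, delete it from $H$, move to the left child; if $e_k$ is standard in $H$ and $e_k\in S$, give it type $S_i$, contract it in $H$, move to the right child; if $e_k$ is an isthmus of $H$, give it type $I$, contract it in $H$, move to the right child. An edge is $\Delta$-active for $S$ if its type is $L$ or $I$. For a spanning tree $T$, the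 internal (resp. external) $\Delta$-active edges are the $\Delta$-active edges in $T$ (resp. not in $T$). -}

module Defs where

open import Data.Nat using (ℕ; zero; suc; _∸_; _<ᵇ_) renaming (_+_ to _+ℕ_; _≡ᵇ_ to _≡ℕᵇ_)
open import Data.Bool using (Bool; true; false; _∧_; _∨_; not; if_then_else_)
open import Data.Fin using (Fin; zero; suc; toℕ; punchOut; _≟_)
open import Data.Product using (_×_; _,_; proj₁; proj₂)
open import Data.List using (List; []; _∷_; map; _++_; [_]; foldr)
open import Data.List.Relation.Unary.All using (All)
open import Data.List.Relation.Binary.Permutation.Propositional using (_↭_)
open import Data.Integer using (ℤ; +_; _*_; _-_; _^_) renaming (_+_ to _+ℤ_)
open import Relation.Nullary using (yes; no; ¬_)
open import Relation.Binary.PropositionalEquality using (_≡_; _≢_; sym)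
import Data.List as L
open import Data.Bool.ListAction using () renaming (any to anyL)

anyF : ∀ {k} → (Fin k → Bool) → Bool
anyF {zero}  f = false
anyF {suc k} f = f zero ∨ anyF (λ i → f (suc i))

countF : ∀ {k} → (Fin k → Bool) → ℕ
countF {zero}  f = 0
countF {suc k} f = (if f zero then 1 else 0) +ℕ countF (λ i → f (suc i))

eqF : ∀ {k} → Fin k → Fin k → Bool
eqF i j with i ≟ j
... | yes _ = true
... | no  _ = false

allFinL : (k : ℕ) → List (Fin k)
allFinL zero    = []
allFinL (suc k) = zero ∷ map suc (allFinL k)

-- Multigraphs (loops and multiple edges allowed) whose edges carry labels
-- from Fin m.  'pres e' says whether edge e is present; 'ends e' are its
-- endpoints (only meaningful when present).  A graph G with vertex set
-- Fin n and edge set Fin m is a 'LGraph m' with every edge present.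

record LGraph (m : ℕ) : Set where
  constructor mkG
  field
    nV   : ℕ
    ends : Fin m → Fin nV × Fin nV
    pres : Fin m → Bool
open LGraph public

-- Spanning subgraphs of G identified with their edge sets.
Subgraph : ℕ → Set
Subgraph m = Fin m → Bool

restrict : ∀ {m} → LGraph m → Subgraph m → LGraph m
restrict H S = mkG (nV H) (ends H) (λ e → pres H e ∧ S e)

adj : ∀ {m} (H : LGraph m) → Fin (nV H) → Fin (nV H) → Bool
adj H a b = anyF λ e → pres H e ∧
  ((eqF (proj₁ (ends H e)) a ∧ eqF (proj₂ (ends H e)) b) ∨
   (eqF (proj₁ (ends H e)) b ∧ eqF (proj₂ (ends H e)) a))

walkWithin : ∀ {m} (H : LGraph m) → ℕ → Fin (nV H) → Fin (nV H) → Bool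
walkWithin H zero    a b = eqF a b
walkWithin H (suc t) a b =
  walkWithin H t a b ∨ anyF (λ c → walkWithin H t a c ∧ adj H c b)

-- a and b are connected (walks of length ≤ number of vertices suffice)
connected : ∀ {m} (H : LGraph m) → Fin (nV H) → Fin (nV H) → Bool
connected H = walkWithin H (nV H)

-- number of connected components: count the vertices that are the
-- smallest vertex of their component.
cc : ∀ {m} → LGraph m → ℕ
cc H = countF λ w → not (anyF λ w' → (toℕ w' <ᵇ toℕ w) ∧ connected H w' w)

size : ∀ {m} → Subgraph m → ℕ
size S = countF S

-- cycl(S) = cc(S) + |S| - |V(G)|   (always ≥ 0)
cycl : ∀ {m} → LGraph m → Subgraph m → ℕ
cycl G S = (cc (restrict G S) +ℕ size S) ∸ nV G

allSubsets : (m : ℕ) → List (Subgraph m)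
allSubsets zero    = [ (λ ()) ]
allSubsets (suc m) =
  L.concatMap (λ S → (λ { zero → false ; (suc i) → S i }) ∷
                     (λ { zero → true  ; (suc i) → S i }) ∷ []) (allSubsets m)

sumℤ : List ℤ → ℤ
sumℤ = foldr _+ℤ_ (+ 0)

tutte : ∀ {m} → LGraph m → ℤ → ℤ → ℤ
tutte {m} G x y = sumℤ (map (λ S →
    ((x - + 1) ^ (cc (restrict G S) ∸ cc G)) * ((y - + 1) ^ cycl G S))
  (allSubsets m))

isSpanningTree : ∀ {m} → LGraph m → Subgraph m → Bool
isSpanningTree G T = (cc (restrict G T) ≡ℕᵇ 1) ∧ (cycl G T ≡ℕᵇ 0)

delete : ∀ {m} → Fin m → LGraph m → LGraph m
delete e H = mkG (nV H) (ends H) (λ f → pres H f ∧ not (eqF f e))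

-- identify v with u (u ≢ v) and remove the vertex v
merge : ∀ {k} (u v : Fin (suc k)) → u ≢ v → Fin (suc k) → Fin k
merge u v u≢v w with w ≟ v
... | yes _   = punchOut {i = v} {j = u} (λ eq → u≢v (sym eq))
... | no w≢v  = punchOut {i = v} {j = w} (λ eq → w≢v (sym eq))

contract : ∀ {m k} (e : Fin m) (ends' : Fin m → Fin (suc k) × Fin (suc k))
  (pres' : Fin m → Bool) → proj₁ (ends' e) ≢ proj₂ (ends' e) → LGraph m
contract {k = k} e ends' pres' ne =
  mkG k (λ f → merge u v ne (proj₁ (ends' f)) , merge u v ne (proj₂ (ends' f)))
        (λ f → pres' f ∧ not (eqF f e))
  where u = proj₁ (ends' e)
        v = proj₂ (ends' e)

data BTree (m : ℕ) : Set where
  leaf : BTree m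
  node : Fin m → BTree m → BTree m → BTree m

paths : ∀ {m} → BTree m → List (List (Fin m))
paths leaf         = [ [] ]
paths (node e l r) = map (e ∷_) (paths l ++ paths r)

IsDecisionTree : ∀ {m} → BTree m → Set
IsDecisionTree {m} Δ = All (λ p → p ↭ allFinL m) (paths Δ)

data EdgeType : Set where
  Se Si L I : EdgeType

assign : ∀ {m} → Subgraph m → LGraph m → BTree m → List (Fin m × EdgeType)
assign S H leaf = []
assign S (mkG zero ends' pres') (node e l r) with proj₁ (ends' e)
... | ()
assign S H@(mkG (suc k) ends' pres') (node e l r)
  with proj₁ (ends' e) ≟ proj₂ (ends' e)
... | yes _  = (e , L) ∷ assign S (delete e H) l
... | no ne  with cc H <ᵇ cc (delete e H) | S e
...   | true  | _     = (e , I)  ∷ assign S (contract e ends' pres' ne) r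
...   | false | false = (e , Se) ∷ assign S (delete e H) l
...   | false | true  = (e , Si) ∷ assign S (contract e ends' pres' ne) r

isActiveType : EdgeType → Bool
isActiveType L = true
isActiveType I = true
isActiveType _ = false

isActive : ∀ {m} → LGraph m → BTree m → Subgraph m → Fin m → Bool
isActive G Δ S e =
  anyL (λ p → eqF (proj₁ p) e ∧ isActiveType (proj₂ p)) (assign S G Δ)

numIntActive : ∀ {m} → LGraph m → BTree m → Subgraph m → ℕ
numIntActive G Δ T = countF λ e → T e ∧ isActive G Δ T e

numExtActive : ∀ {m} → LGraph m → BTree m → Subgraph m → ℕ
numExtActive G Δ T = countF λ e → not (T e) ∧ isActive G Δ T e

activitySum : ∀ {m} → LGraph m → BTree m → ℤ → ℤ → ℤ
activitySum {m} G Δ x y = sumℤ (map (λ T →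
    if isSpanningTree G T
      then (x ^ numIntActive G Δ T) * (y ^ numExtActive G Δ T)
      else + 0)
  (allSubsets m))

graph : (n m : ℕ) → (Fin m → Fin n × Fin n) → LGraph m
graph n m ends' = mkG n ends' (λ _ → true)

-- Both sides obey the same deletion–contraction recursion along the decision tree.
-- Splitting the sum over spanning subgraphs S by whether S contains the root label e:
-- if e is a loop, T_G = y T_{G∖e}, and e is externally active (type L) for every
-- spanning tree, none of which contains it; if e is an isthmus, T_G = x T_{G/e}, and
-- e lies in every spanning tree, where it is internally active (type I); otherwise
-- T_G = T_{G∖e} + T_{G/e}, matching the spanning trees without e (left subtree, G∖e)
-- and with e (right subtree, G/e), for which e is inactive. The induction runs over
-- graphs H whose edges are a subset pres H of the labels, with Δ a decision tree for
-- that subset; the leaf case is a single vertex without edges.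

module Submission where

open import Defs
open import Data.Nat as ℕ using (ℕ; zero; suc; _≤_; _<_; z≤n; s≤s; _<ᵇ_; _∸_) renaming (_+_ to _+ℕ_)
import Data.Nat.Properties as ℕₚ
open import Data.Bool using (Bool; true; false; _∧_; _∨_; not; if_then_else_)
import Data.Bool.Properties as Boolₚ
open import Data.Bool.Properties using (not-¬)
open import Data.Bool.ListAction using () renaming (any to anyL)
open import Data.Fin using (Fin; zero; suc; toℕ; punchIn; _≟_)
import Data.Fin.Properties as Finₚ
open import Data.Product using (Σ; _×_; _,_; proj₁; proj₂)
open import Data.Sum using (_⊎_; inj₁; inj₂; [_,_]′)
open import Data.Empty using (⊥; ⊥-elim)
open import Data.List using (List; []; _∷_; map; _++_; concatMap)
open import Data.List.Relation.Unary.All as All using (All; []; _∷_)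
import Data.List.Relation.Unary.All.Properties as Allₚ
open import Data.List.Relation.Binary.Permutation.Propositional as Perm using (_↭_)
open import Data.Integer using (ℤ; +_; _*_; _-_; _^_) renaming (_+_ to _+ℤ_)
import Data.Integer.Properties as ℤₚ
open import Data.Integer.Tactic.RingSolver using (solve-∀)
import Algebra.Properties.CommutativeSemigroup as CommSemigroupₚ
open import Function.Bundles using (Equivalence)
open import Relation.Nullary using (Dec; yes; no; ¬_)
open import Relation.Binary.Structures using (IsEquivalence)
open import Relation.Binary.Definitions using (tri<; tri≈; tri>)
open import Relation.Binary.PropositionalEquality

module ℕ+ = CommSemigroupₚ ℕₚ.+-commutativeSemigroup
module ℤ+ = CommSemigroupₚ ℤₚ.+-commutativeSemigroup
module ℤ* = CommSemigroupₚ ℤₚ.*-commutativeSemigroup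

∧-trueˡ : ∀ {a b} → a ∧ b ≡ true → a ≡ true
∧-trueˡ {true} _ = refl

∧-trueʳ : ∀ {a b} → a ∧ b ≡ true → b ≡ true
∧-trueʳ {true} h = h

∧-true : ∀ {a b} → a ≡ true → b ≡ true → a ∧ b ≡ true
∧-true refl refl = refl

∨-true⁻ : ∀ {a b} → a ∨ b ≡ true → a ≡ true ⊎ b ≡ true
∨-true⁻ {true}  _ = inj₁ refl
∨-true⁻ {false} h = inj₂ h

∨-trueˡ : ∀ {a} b → a ≡ true → a ∨ b ≡ true
∨-trueˡ b refl = refl

∨-trueʳ : ∀ a {b} → b ≡ true → a ∨ b ≡ true
∨-trueʳ true  _ = refl
∨-trueʳ false h = h

not-true : ∀ {a} → not a ≡ true → a ≡ false
not-true {false} _ = refl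

not-false : ∀ {a} → not a ≡ false → a ≡ true
not-false {true} _ = refl

≢true⇒false : ∀ {a} → ¬ (a ≡ true) → a ≡ false
≢true⇒false {false} _ = refl
≢true⇒false {true}  h = ⊥-elim (h refl)

<ᵇ⇒< : ∀ {a b} → (a <ᵇ b) ≡ true → a < b
<ᵇ⇒< {a} {b} h = ℕₚ.<ᵇ⇒< a b (Equivalence.from Boolₚ.T-≡ h)

<⇒<ᵇ : ∀ {a b} → a < b → (a <ᵇ b) ≡ true
<⇒<ᵇ h = Equivalence.to Boolₚ.T-≡ (ℕₚ.<⇒<ᵇ h)

eqF-refl : ∀ {k} (i : Fin k) → eqF i i ≡ true
eqF-refl i with i ≟ i
... | yes _ = refl
... | no ne = ⊥-elim (ne refl)

eqF⇒≡ : ∀ {k} {i j : Fin k} → eqF i j ≡ true → i ≡ j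
eqF⇒≡ {i = i} {j} h with i ≟ j
... | yes p = p
eqF⇒≡ () | no _

≡⇒eqF : ∀ {k} {i j : Fin k} → i ≡ j → eqF i j ≡ true
≡⇒eqF refl = eqF-refl _

≢⇒eqF : ∀ {k} {i j : Fin k} → i ≢ j → eqF i j ≡ false
≢⇒eqF {i = i} {j} ne with i ≟ j
... | yes p = ⊥-elim (ne p)
... | no _  = refl

eqF-sym : ∀ {k} (i j : Fin k) → eqF i j ≡ eqF j i
eqF-sym i j with i ≟ j
... | yes refl = sym (eqF-refl i)
... | no ne    = sym (≢⇒eqF (λ e → ne (sym e)))

eqF-suc : ∀ {k} (i j : Fin k) → eqF (suc i) (suc j) ≡ eqF i j
eqF-suc i j = helper (i ≟ j)
  where
    helper : Dec (i ≡ j) → eqF (suc i) (suc j) ≡ eqF i j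
    helper (yes refl) = trans (eqF-refl (suc i)) (sym (eqF-refl i))
    helper (no ne)    = trans (≢⇒eqF (λ e → ne (Finₚ.suc-injective e))) (sym (≢⇒eqF ne))

anyF-intro : ∀ {k} (f : Fin k → Bool) (i : Fin k) → f i ≡ true → anyF f ≡ true
anyF-intro f zero    h rewrite h = refl
anyF-intro f (suc i) h = ∨-trueʳ (f zero) (anyF-intro (λ j → f (suc j)) i h)

anyF-elim : ∀ {k} (f : Fin k → Bool) → anyF f ≡ true → Σ (Fin k) λ i → f i ≡ true
anyF-elim {suc k} f h with ∨-true⁻ {f zero} h
... | inj₁ p = zero , p
... | inj₂ p with anyF-elim (λ j → f (suc j)) p
... | i , q = suc i , q

anyF-false : ∀ {k} (f : Fin k → Bool) → anyF f ≡ false → ∀ i → f i ≡ false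
anyF-false f h i = ≢true⇒false (λ p → not-¬ h (anyF-intro f i p))

anyF-none : ∀ {k} (f : Fin k → Bool) → (∀ i → f i ≡ false) → anyF f ≡ false
anyF-none f h = ≢true⇒false (λ p → let (i , q) = anyF-elim f p in not-¬ (h i) q)

anyF-cong : ∀ {k} {f g : Fin k → Bool} → (∀ i → f i ≡ g i) → anyF f ≡ anyF g
anyF-cong {zero}  h = refl
anyF-cong {suc k} h = cong₂ _∨_ (h zero) (anyF-cong (λ i → h (suc i)))

ind : Bool → ℕ
ind b = if b then 1 else 0

countF-cong : ∀ {k} {f g : Fin k → Bool} → (∀ i → f i ≡ g i) → countF f ≡ countF g
countF-cong {zero}  h = refl
countF-cong {suc k} h = cong₂ (λ a b → ind a +ℕ b) (h zero) (countF-cong (λ i → h (suc i)))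

countF-false : ∀ {k} (f : Fin k → Bool) → (∀ i → f i ≡ false) → countF f ≡ 0
countF-false {zero}  f h = refl
countF-false {suc k} f h rewrite h zero = countF-false (λ i → f (suc i)) (λ i → h (suc i))

countF-true : ∀ {k} (f : Fin k → Bool) → (∀ i → f i ≡ true) → countF f ≡ k
countF-true {zero}  f h = refl
countF-true {suc k} f h rewrite h zero = cong suc (countF-true (λ i → f (suc i)) (λ i → h (suc i)))

countF≤ : ∀ {k} (f : Fin k → Bool) → countF f ≤ k
countF≤ {zero}  f = z≤n
countF≤ {suc k} f with f zero
... | true  = s≤s (countF≤ (λ i → f (suc i)))
... | false = ℕₚ.m≤n⇒m≤1+n (countF≤ (λ i → f (suc i)))

countF-mono : ∀ {k} {f g : Fin k → Bool} → (∀ i → f i ≡ true → g i ≡ true) → countF f ≤ countF g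
countF-mono {zero} h = z≤n
countF-mono {suc k} {f} {g} h with f zero in ef | g zero in eg
... | true  | true  = s≤s (countF-mono (λ i → h (suc i)))
... | false | true  = ℕₚ.m≤n⇒m≤1+n (countF-mono (λ i → h (suc i)))
... | false | false = countF-mono (λ i → h (suc i))
... | true  | false = ⊥-elim (not-¬ eg (h zero ef))

countF-split : ∀ {k} (f : Fin k → Bool) (e : Fin k) →
  countF f ≡ ind (f e) +ℕ countF (λ i → f i ∧ not (eqF i e))
countF-split {suc k} f zero rewrite Boolₚ.∧-zeroʳ (f zero) =
  cong (ind (f zero) +ℕ_) (countF-cong λ i → sym (Boolₚ.∧-identityʳ (f (suc i))))
countF-split {suc k} f (suc e)
  rewrite Boolₚ.∧-identityʳ (f zero) | countF-split (λ i → f (suc i)) e =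
  trans (ℕ+.x∙yz≈y∙xz (ind (f zero)) (ind (f (suc e))) _)
        (cong (λ z → ind (f (suc e)) +ℕ (ind (f zero) +ℕ z))
              (countF-cong λ i → cong (λ b → f (suc i) ∧ not b) (sym (eqF-suc i e))))

countF-remove : ∀ {k} (f : Fin k → Bool) (e : Fin k) → f e ≡ true →
  countF f ≡ suc (countF (λ i → f i ∧ not (eqF i e)))
countF-remove f e h = trans (countF-split f e) (cong (λ b → ind b +ℕ countF (λ i → f i ∧ not (eqF i e))) h)

countF≡0 : ∀ {k} (f : Fin k → Bool) → countF f ≡ 0 → ∀ i → f i ≡ false
countF≡0 f h i = ≢true⇒false λ fi → ℕₚ.1+n≢0 (trans (sym (countF-remove f i fi)) h)

countF≡suc : ∀ {k} (f : Fin k → Bool) {c} → countF f ≡ suc c → Σ (Fin k) λ i → f i ≡ true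
countF≡suc {suc k} f h with f zero in e0
... | true  = zero , e0
... | false with countF≡suc (λ i → f (suc i)) h
... | i , q = suc i , q

countF-injection : ∀ {k k'} (P : Fin k → Bool) (Q : Fin k' → Bool) (g : Fin k → Fin k') →
  (∀ i → P i ≡ true → Q (g i) ≡ true) →
  (∀ i j → P i ≡ true → P j ≡ true → g i ≡ g j → i ≡ j) →
  countF P ≤ countF Q
countF-injection {zero} P Q g hP hI = z≤n
countF-injection {suc k} P Q g hP hI with P zero in e0
... | false = countF-injection (λ i → P (suc i)) Q (λ i → g (suc i)) (λ i → hP (suc i))
                (λ i j pi pj eq → Finₚ.suc-injective (hI (suc i) (suc j) pi pj eq))
... | true = subst (suc (countF (λ i → P (suc i))) ≤_) (sym (countF-remove Q (g zero) (hP zero e0)))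
      (s≤s (countF-injection (λ i → P (suc i)) (λ i → Q i ∧ not (eqF i (g zero))) (λ i → g (suc i))
        (λ i pi → ∧-true (hP (suc i) pi)
                    (cong not (≢⇒eqF λ eq → Finₚ.0≢1+n (hI zero (suc i) e0 pi (sym eq)))))
        (λ i j pi pj eq → Finₚ.suc-injective (hI (suc i) (suc j) pi pj eq))))

-- Counting the classes of an equivalence relation by their least elements

IsBoolEquivalence : ∀ {n} → (Fin n → Fin n → Bool) → Set
IsBoolEquivalence R = IsEquivalence (λ a b → R a b ≡ true)

isLeast : ∀ {n} → (Fin n → Fin n → Bool) → Fin n → Bool
isLeast R w = not (anyF λ w' → (toℕ w' <ᵇ toℕ w) ∧ R w' w)

-- cc H is classes (connected H) by definition
classes : ∀ {n} → (Fin n → Fin n → Bool) → ℕ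
classes R = countF (isLeast R)

classes-anti : ∀ {n} {R₁ R₂ : Fin n → Fin n → Bool} → (∀ a b → R₁ a b ≡ true → R₂ a b ≡ true) →
  classes R₂ ≤ classes R₁
classes-anti h = countF-mono λ w l₂ → cong not (anyF-none _ λ w' → ≢true⇒false λ q →
  not-¬ (anyF-false _ (not-true l₂) w') (∧-true (∧-trueˡ q) (h w' w (∧-trueʳ q))))

module LeastElements {n} (R : Fin n → Fin n → Bool) (E : IsBoolEquivalence R) where
  private module E = IsEquivalence E

  isLeast-below : ∀ {w} → isLeast R w ≡ true → ∀ w' → toℕ w' < toℕ w → R w' w ≡ false
  isLeast-below {w} h w' lt = ≢true⇒false λ p → not-¬ (not-true h)
    (anyF-intro (λ w'' → (toℕ w'' <ᵇ toℕ w) ∧ R w'' w) w' (∧-true (<⇒<ᵇ lt) p))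

  least-exists : ∀ b w → toℕ w < b → Σ (Fin n) λ m → R m w ≡ true × isLeast R m ≡ true
  least-exists (suc b) w lt with isLeast R w in el
  ... | true = w , E.refl , el
  ... | false with anyF-elim (λ w' → (toℕ w' <ᵇ toℕ w) ∧ R w' w) (not-false el)
  ... | w' , q with least-exists b w' (ℕₚ.<-≤-trans (<ᵇ⇒< (∧-trueˡ q)) (ℕₚ.≤-pred lt))
  ... | m , rm , lm = m , E.trans rm (∧-trueʳ q) , lm

  least : Fin n → Fin n
  least w = proj₁ (least-exists n w (Finₚ.toℕ<n w))

  least-related : ∀ w → R (least w) w ≡ true
  least-related w = proj₁ (proj₂ (least-exists n w (Finₚ.toℕ<n w)))

  least-isLeast : ∀ w → isLeast R (least w) ≡ true
  least-isLeast w = proj₂ (proj₂ (least-exists n w (Finₚ.toℕ<n w)))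

  isLeast-unique : ∀ {a b} → isLeast R a ≡ true → isLeast R b ≡ true → R a b ≡ true → a ≡ b
  isLeast-unique {a} {b} la lb r with ℕₚ.<-cmp (toℕ a) (toℕ b)
  ... | tri< lt _ _ = ⊥-elim (not-¬ (isLeast-below lb a lt) r)
  ... | tri≈ _ eq _ = Finₚ.toℕ-injective eq
  ... | tri> _ _ gt = ⊥-elim (not-¬ (isLeast-below la b gt) (E.sym r))

  least-injective : ∀ {a b} → least a ≡ least b → R a b ≡ true
  least-injective {a} {b} eq =
    E.trans (E.sym (least-related a)) (subst (λ z → R z b ≡ true) (sym eq) (least-related b))

-- f identifies u with v and R' is the quotient of R by this: f a and f b are related
-- exactly when a and b are, or both lie in the classes of u and v.
module GlueTwo {k} (R : Fin (suc k) → Fin (suc k) → Bool) (R' : Fin k → Fin k → Bool)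
  (E : IsBoolEquivalence R) (E' : IsBoolEquivalence R')
  (f : Fin (suc k) → Fin k) (s : Fin k → Fin (suc k)) (f∘s : ∀ w → f (s w) ≡ w)
  (u v : Fin (suc k))
  (μu~μv : R' (f u) (f v) ≡ true)
  (fwd : ∀ {a b} → R a b ≡ true → R' (f a) (f b) ≡ true)
  (bwd : ∀ {a b} → R' (f a) (f b) ≡ true →
           R a b ≡ true ⊎ ((R a u ∨ R a v) ≡ true × (R b u ∨ R b v) ≡ true))
  where
  private
    module E = IsEquivalence E
    module E' = IsEquivalence E'
  open LeastElements R E
  open LeastElements R' E' using ()
    renaming (least to least'; least-isLeast to least'-isLeast;
              isLeast-unique to isLeast'-unique; least-injective to least'-injective)

  R'-section : ∀ {w₁ w₂} → R' (f (s w₁)) (f (s w₂)) ≡ true → R' w₁ w₂ ≡ true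
  R'-section {w₁} {w₂} = subst₂ (λ a b → R' a b ≡ true) (f∘s w₁) (f∘s w₂)

  classes-related : R u v ≡ true → classes R ≡ classes R'
  classes-related u~v = ℕₚ.≤-antisym
    (countF-injection (isLeast R) (isLeast R') (λ w → least' (f w)) (λ w _ → least'-isLeast (f w))
      λ w₁ w₂ l₁ l₂ eq → isLeast-unique l₁ l₂ (reflect (least'-injective eq)))
    (countF-injection (isLeast R') (isLeast R) (λ w → least (s w)) (λ w _ → least-isLeast (s w))
      λ w₁ w₂ l₁ l₂ eq → isLeast'-unique l₁ l₂ (R'-section (fwd (least-injective eq))))
    where
      to-u : ∀ {c} → (R c u ∨ R c v) ≡ true → R c u ≡ true
      to-u {c} h with ∨-true⁻ {R c u} h
      ... | inj₁ p = p
      ... | inj₂ p = E.trans p (E.sym u~v)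
      reflect : ∀ {a b} → R' (f a) (f b) ≡ true → R a b ≡ true
      reflect h with bwd h
      ... | inj₁ p = p
      ... | inj₂ (ua , ub) = E.trans (to-u ua) (E.sym (to-u ub))

  -- Removing the class of v, the remaining least elements correspond to those of R'.
  classes-unrelated : R u v ≡ false → classes R ≡ suc (classes R')
  classes-unrelated u≁v =
    trans (countF-remove (isLeast R) z (least-isLeast v)) (cong suc (ℕₚ.≤-antisym le ge))
    where
      z : Fin (suc k)
      z = least v
      P : Fin (suc k) → Bool
      P w = isLeast R w ∧ not (eqF w z)
      P⇒≁v : ∀ {w} → P w ≡ true → R w v ≡ false
      P⇒≁v {w} pw = ≢true⇒false λ r → not-¬ (not-true (∧-trueʳ pw))
        (≡⇒eqF (isLeast-unique (∧-trueˡ pw) (least-isLeast v) (E.trans r (E.sym (least-related v)))))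
      to-u : ∀ {w} → P w ≡ true → (R w u ∨ R w v) ≡ true → R w u ≡ true
      to-u {w} pw h with ∨-true⁻ {R w u} h
      ... | inj₁ p = p
      ... | inj₂ p = ⊥-elim (not-¬ (P⇒≁v pw) p)
      reflect : ∀ {a b} → P a ≡ true → P b ≡ true → R' (f a) (f b) ≡ true → R a b ≡ true
      reflect pa pb h with bwd h
      ... | inj₁ p = p
      ... | inj₂ (ua , ub) = E.trans (to-u pa ua) (E.sym (to-u pb ub))
      le : countF P ≤ classes R'
      le = countF-injection P (isLeast R') (λ w → least' (f w)) (λ w _ → least'-isLeast (f w))
        λ w₁ w₂ p₁ p₂ eq → isLeast-unique (∧-trueˡ p₁) (∧-trueˡ p₂) (reflect p₁ p₂ (least'-injective eq))
      -- the class of R' containing f v is represented by the class of u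
      g : Fin k → Fin (suc k)
      g w = if R (s w) v then least u else least (s w)
      P-intro : ∀ {w} → isLeast R w ≡ true → w ≢ z → P w ≡ true
      P-intro l w≢z = ∧-true l (cong not (≢⇒eqF w≢z))
      g-P : ∀ w → isLeast R' w ≡ true → P (g w) ≡ true
      g-P w _ with R (s w) v in sw~v
      ... | true  = P-intro (least-isLeast u) (λ eq → not-¬ u≁v (least-injective eq))
      ... | false = P-intro (least-isLeast (s w)) (λ eq → not-¬ sw~v (least-injective eq))
      g-injective : ∀ w₁ w₂ → isLeast R' w₁ ≡ true → isLeast R' w₂ ≡ true → g w₁ ≡ g w₂ → w₁ ≡ w₂
      g-injective w₁ w₂ l₁ l₂ eq with R (s w₁) v in e₁ | R (s w₂) v in e₂
      ... | true  | true  = isLeast'-unique l₁ l₂ (R'-section (fwd (E.trans e₁ (E.sym e₂))))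
      ... | false | false = isLeast'-unique l₁ l₂ (R'-section (fwd (least-injective eq)))
      ... | true  | false = isLeast'-unique l₁ l₂ (R'-section
              (E'.trans (fwd e₁) (E'.trans (E'.sym μu~μv) (fwd (least-injective eq)))))
      ... | false | true  = isLeast'-unique l₁ l₂ (R'-section
              (E'.trans (fwd (least-injective eq)) (E'.trans μu~μv (fwd (E.sym e₂)))))
      ge : classes R' ≤ countF P
      ge = countF-injection (isLeast R') P g g-P g-injective

module Walks {m} (H : LGraph m) where
  private
    n : ℕ
    n = nV H
    W : ℕ → Fin n → Fin n → Bool
    W = walkWithin H

  Links : Fin m → Fin n → Fin n → Set
  Links e a b = (proj₁ (ends H e) ≡ a × proj₂ (ends H e) ≡ b) ⊎ (proj₁ (ends H e) ≡ b × proj₂ (ends H e) ≡ a)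

  joins : Fin n → Fin n → Fin m → Bool
  joins a b e = pres H e ∧ ((eqF (proj₁ (ends H e)) a ∧ eqF (proj₂ (ends H e)) b) ∨
                            (eqF (proj₁ (ends H e)) b ∧ eqF (proj₂ (ends H e)) a))

  adj-intro : ∀ {a b} e → pres H e ≡ true → proj₁ (ends H e) ≡ a → proj₂ (ends H e) ≡ b → adj H a b ≡ true
  adj-intro {a} {b} e p x y = anyF-intro (joins a b) e (∧-true p
    (∨-trueˡ (eqF (proj₁ (ends H e)) b ∧ eqF (proj₂ (ends H e)) a) (∧-true (≡⇒eqF x) (≡⇒eqF y))))

  adj-elim : ∀ {a b} → adj H a b ≡ true → Σ (Fin m) λ e → pres H e ≡ true × Links e a b
  adj-elim {a} {b} h with anyF-elim (joins a b) h
  ... | e , q with ∨-true⁻ (∧-trueʳ q)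
  ... | inj₁ r = e , ∧-trueˡ q , inj₁ (eqF⇒≡ (∧-trueˡ r) , eqF⇒≡ (∧-trueʳ r))
  ... | inj₂ r = e , ∧-trueˡ q , inj₂ (eqF⇒≡ (∧-trueˡ r) , eqF⇒≡ (∧-trueʳ r))

  adj-sym : ∀ {a b} → adj H a b ≡ true → adj H b a ≡ true
  adj-sym h with adj-elim h
  ... | e , p , inj₁ (x , y) = anyF-intro (joins _ _) e (∧-true p (∨-trueʳ _ (∧-true (≡⇒eqF x) (≡⇒eqF y))))
  ... | e , p , inj₂ (x , y) = adj-intro e p x y

  walk-step : ∀ {t a b} → W t a b ≡ true → W (suc t) a b ≡ true
  walk-step {t} {a} {b} = ∨-trueˡ (anyF λ c → W t a c ∧ adj H c b)

  walk-snoc : ∀ {t a b c} → W t a c ≡ true → adj H c b ≡ true → W (suc t) a b ≡ true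
  walk-snoc {t} {a} {b} {c} h₁ h₂ = ∨-trueʳ (W t a b) (anyF-intro (λ c → W t a c ∧ adj H c b) c (∧-true h₁ h₂))

  walk-mono : ∀ {t t' a b} → t ≤ t' → W t a b ≡ true → W t' a b ≡ true
  walk-mono {t} le h with ℕₚ.m≤n⇒∃[o]m+o≡n le
  ... | d , refl = go d
    where
      go : ∀ d → W (t +ℕ d) _ _ ≡ true
      go zero    rewrite ℕₚ.+-identityʳ t = h
      go (suc d) rewrite ℕₚ.+-suc t d = walk-step {t +ℕ d} (go d)

  walk-++ : ∀ {s t a b c} → W s a b ≡ true → W t b c ≡ true → W (s +ℕ t) a c ≡ true
  walk-++ {s} {zero} h₁ h₂ rewrite ℕₚ.+-identityʳ s | eqF⇒≡ h₂ = h₁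
  walk-++ {s} {suc t} {a} {b} {c} h₁ h₂ rewrite ℕₚ.+-suc s t with ∨-true⁻ {W t b c} h₂
  ... | inj₁ p = walk-step {s +ℕ t} (walk-++ {s} {t} h₁ p)
  ... | inj₂ p with anyF-elim (λ d → W t b d ∧ adj H d c) p
  ... | d , q = walk-snoc {s +ℕ t} (walk-++ {s} {t} h₁ (∧-trueˡ q)) (∧-trueʳ q)

  walk-sym : ∀ {t a b} → W t a b ≡ true → W t b a ≡ true
  walk-sym {zero} {a} {b} h rewrite eqF⇒≡ h = eqF-refl b
  walk-sym {suc t} {a} {b} h with ∨-true⁻ {W t a b} h
  ... | inj₁ p = walk-step {t} (walk-sym {t} p)
  ... | inj₂ p with anyF-elim (λ c → W t a c ∧ adj H c b) p
  ... | c , q = walk-++ {1} {t} (walk-snoc {0} (eqF-refl b) (adj-sym (∧-trueʳ q))) (walk-sym {t} (∧-trueˡ q))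

  walk-ind : (Q : Fin n → Fin n → Set) → (∀ a → Q a a) → (∀ {a b c} → Q a b → Q b c → Q a c) →
    (∀ {a b} → adj H a b ≡ true → Q a b) → ∀ t {a b} → W t a b ≡ true → Q a b
  walk-ind Q qrefl qtrans qadj zero h rewrite eqF⇒≡ h = qrefl _
  walk-ind Q qrefl qtrans qadj (suc t) {a} {b} h with ∨-true⁻ {W t a b} h
  ... | inj₁ p = walk-ind Q qrefl qtrans qadj t p
  ... | inj₂ p with anyF-elim (λ c → W t a c ∧ adj H c b) p
  ... | c , q = qtrans (walk-ind Q qrefl qtrans qadj t (∧-trueˡ q)) (qadj (∧-trueʳ q))

  -- The set of vertices reachable from a within t steps grows with t; it can grow
  -- strictly at most n - 1 times, and once it stops growing it is constant.
  module Reach (a : Fin n) where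
    grows : ℕ → Bool
    grows t = anyF λ b → W (suc t) a b ∧ not (W t a b)

    stalled : ∀ {t} → grows t ≡ false → ∀ b → W (suc t) a b ≡ W t a b
    stalled {t} g b with W t a b in e
    ... | true  = refl
    ... | false = ≢true⇒false λ p → not-¬ (anyF-false _ g b)
        (∧-true (trans (cong (λ z → z ∨ anyF (λ c → W t a c ∧ adj H c b)) e) p) (cong not e))

    stalled-forever : ∀ {t} → (∀ b → W (suc t) a b ≡ W t a b) → ∀ d b → W (d +ℕ t) a b ≡ W t a b
    stalled-forever h zero b = refl
    stalled-forever {t} h (suc d) b = trans (go d b) (stalled-forever h d b)
      where
        go : ∀ d b → W (suc (d +ℕ t)) a b ≡ W (d +ℕ t) a b
        go zero    b = h b
        go (suc d) b = cong₂ _∨_ (go d b) (anyF-cong λ c → cong (_∧ adj H c b) (go d c))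

    grows⇒size : ∀ t → (∀ t' → t' < t → grows t' ≡ true) → suc t ≤ countF (W t a)
    grows⇒size zero _ rewrite countF-remove (W 0 a) a (eqF-refl a) = s≤s z≤n
    grows⇒size (suc t) h with anyF-elim _ (h t ℕₚ.≤-refl)
    ... | b , q = ℕₚ.≤-trans (s≤s (grows⇒size t (λ t' lt → h t' (ℕₚ.m≤n⇒m≤1+n lt))))
        (ℕₚ.≤-trans (s≤s (countF-mono {f = W t a} {g = λ c → W (suc t) a c ∧ not (eqF c b)}
          (λ c wc → ∧-true (walk-step {t} wc) (cong not (≢⇒eqF λ eq → not-¬ (not-true (∧-trueʳ q))
              (subst (λ z → W t a z ≡ true) eq wc))))))
          (ℕₚ.≤-reflexive (sym (countF-remove _ b (∧-trueˡ q)))))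

    first-stall : ∀ t → (Σ ℕ λ t₀ → t₀ < t × grows t₀ ≡ false) ⊎ (∀ t' → t' < t → grows t' ≡ true)
    first-stall zero = inj₂ (λ t' ())
    first-stall (suc t) with first-stall t
    ... | inj₁ (t₀ , lt , g) = inj₁ (t₀ , ℕₚ.m≤n⇒m≤1+n lt , g)
    ... | inj₂ h with grows t in e
    ... | false = inj₁ (t , ℕₚ.≤-refl , e)
    ... | true  = inj₂ λ t' lt → [ h t' , (λ { refl → e }) ]′ (ℕₚ.m≤n⇒m<n∨m≡n (ℕₚ.≤-pred lt))

    stall-point : Σ ℕ λ t₀ → t₀ < n × (∀ b → W (suc t₀) a b ≡ W t₀ a b)
    stall-point with first-stall n
    ... | inj₁ (t₀ , lt , g) = t₀ , lt , stalled {t₀} g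
    ... | inj₂ h = ⊥-elim (ℕₚ.<-irrefl refl (ℕₚ.≤-trans (grows⇒size n h) (countF≤ (W n a))))

    walk⇒connected : ∀ t b → W t a b ≡ true → connected H a b ≡ true
    walk⇒connected t b h with ℕₚ.≤-total t n
    ... | inj₁ le = walk-mono le h
    ... | inj₂ le with stall-point
    ... | t₀ , lt , st = trans (reach n (ℕₚ.<⇒≤ lt)) (trans (sym (reach t (ℕₚ.≤-trans (ℕₚ.<⇒≤ lt) le))) h)
      where
        reach : ∀ s → t₀ ≤ s → W s a b ≡ W t₀ a b
        reach s t₀≤s = trans (cong (λ z → W z a b) (sym (ℕₚ.m∸n+n≡m t₀≤s))) (stalled-forever st (s ∸ t₀) b)

  connected-refl : ∀ a → connected H a a ≡ true
  connected-refl a = walk-mono {0} {n} z≤n (eqF-refl a)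

  connected-sym : ∀ {a b} → connected H a b ≡ true → connected H b a ≡ true
  connected-sym = walk-sym {n}

  connected-trans : ∀ {a b c} → connected H a b ≡ true → connected H b c ≡ true → connected H a c ≡ true
  connected-trans {a} {b} {c} h₁ h₂ = Reach.walk⇒connected a (n +ℕ n) c (walk-++ {n} {n} h₁ h₂)

  adj⇒connected : ∀ {a b} → adj H a b ≡ true → connected H a b ≡ true
  adj⇒connected {a} h = walk-mono {1} (ℕₚ.≤-trans (s≤s z≤n) (Finₚ.toℕ<n a)) (walk-snoc {0} (eqF-refl a) h)

  edge⇒connected : ∀ e → pres H e ≡ true → connected H (proj₁ (ends H e)) (proj₂ (ends H e)) ≡ true
  edge⇒connected e p = adj⇒connected (adj-intro e p refl refl)

  connected-isEquivalence : IsBoolEquivalence (connected H)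
  connected-isEquivalence = record
    { refl = connected-refl _ ; sym = connected-sym ; trans = connected-trans }

  connected-ind : (Q : Fin n → Fin n → Set) → (∀ a → Q a a) → (∀ {a b c} → Q a b → Q b c → Q a c) →
    (∀ {a b} → adj H a b ≡ true → Q a b) → ∀ {a b} → connected H a b ≡ true → Q a b
  connected-ind Q qrefl qtrans qadj = walk-ind Q qrefl qtrans qadj n

-- Components under deletion and contraction

module EdgeSets {m n : ℕ} (ends' : Fin m → Fin n × Fin n) where
  G : (Fin m → Bool) → LGraph m
  G p = mkG n ends' p

  connected-mono : ∀ {p₁ p₂} → (∀ e → p₁ e ≡ true → p₂ e ≡ true) →
    ∀ {a b} → connected (G p₁) a b ≡ true → connected (G p₂) a b ≡ true
  connected-mono {p₁} {p₂} h = W₁.connected-ind (λ a b → connected (G p₂) a b ≡ true)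
    W₂.connected-refl W₂.connected-trans step
    where
      module W₁ = Walks (G p₁)
      module W₂ = Walks (G p₂)
      step : ∀ {a b} → adj (G p₁) a b ≡ true → connected (G p₂) a b ≡ true
      step hab with W₁.adj-elim hab
      ... | e , pe , inj₁ (x , y) = W₂.adj⇒connected (W₂.adj-intro e (h e pe) x y)
      ... | e , pe , inj₂ (x , y) = W₂.adj⇒connected (W₂.adj-sym (W₂.adj-intro e (h e pe) x y))

  cc-anti : ∀ {p₁ p₂} → (∀ e → p₁ e ≡ true → p₂ e ≡ true) → cc (G p₂) ≤ cc (G p₁)
  cc-anti {p₁} {p₂} h = classes-anti {R₁ = connected (G p₁)} {R₂ = connected (G p₂)} (λ a b → connected-mono h)

  cc-cong : ∀ {p₁ p₂} → (∀ e → p₁ e ≡ p₂ e) → cc (G p₁) ≡ cc (G p₂)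
  cc-cong h = ℕₚ.≤-antisym (cc-anti (λ e q → trans (h e) q)) (cc-anti (λ e q → trans (sym (h e)) q))

  cc-delete-cycleEdge : ∀ (p : Fin m → Bool) e →
    connected (G (λ f → p f ∧ not (eqF f e))) (proj₁ (ends' e)) (proj₂ (ends' e)) ≡ true →
    cc (G p) ≡ cc (G (λ f → p f ∧ not (eqF f e)))
  cc-delete-cycleEdge p e h =
    ℕₚ.≤-antisym (cc-anti (λ f q → ∧-trueˡ q)) (classes-anti {R₁ = connected (G p)} {R₂ = connected (G p₂)}
      (λ a b → W₁.connected-ind Q W₂.connected-refl W₂.connected-trans step))
    where
      p₂ : Fin m → Bool
      p₂ f = p f ∧ not (eqF f e)
      Q : Fin n → Fin n → Set
      Q a b = connected (G p₂) a b ≡ true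
      module W₁ = Walks (G p)
      module W₂ = Walks (G p₂)
      via : ∀ g → p₂ g ≡ true → ∀ {a b} → W₂.Links g a b → Q a b
      via g pg (inj₁ (x , y)) = W₂.adj⇒connected (W₂.adj-intro g pg x y)
      via g pg (inj₂ (x , y)) = W₂.adj⇒connected (W₂.adj-sym (W₂.adj-intro g pg x y))
      step : ∀ {a b} → adj (G p) a b ≡ true → Q a b
      step hab with W₁.adj-elim hab
      ... | g , pg , ori with eqF g e in g≟e
      ... | false = via g (∧-true pg (cong not g≟e)) ori
      ... | true with eqF⇒≡ g≟e | ori
      ... | refl | inj₁ (refl , refl) = h
      ... | refl | inj₂ (refl , refl) = W₂.connected-sym h

  cc-edgeless : ∀ (p : Fin m → Bool) → (∀ e → p e ≡ false) → cc (G p) ≡ n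
  cc-edgeless p h = countF-true (isLeast (connected (G p))) λ w →
    cong not (anyF-none (λ w' → (toℕ w' <ᵇ toℕ w) ∧ connected (G p) w' w) λ w' → ≢true⇒false λ q →
      ℕₚ.<-irrefl (cong toℕ (trivial (∧-trueʳ q))) (<ᵇ⇒< (∧-trueˡ q)))
    where
      trivial : ∀ {a b} → connected (G p) a b ≡ true → a ≡ b
      trivial = Walks.connected-ind (G p) _≡_ (λ _ → refl) trans
        (λ hab → let (g , pg , _) = Walks.adj-elim (G p) hab in ⊥-elim (not-¬ (h g) pg))

module Merge {k : ℕ} (u v : Fin (suc k)) (u≢v : u ≢ v) where
  μ : Fin (suc k) → Fin k
  μ = merge u v u≢v

  merge-identifies : μ u ≡ μ v
  merge-identifies with u ≟ v | v ≟ v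
  ... | yes eq | _     = ⊥-elim (u≢v eq)
  ... | no _   | no nv = ⊥-elim (nv refl)
  ... | no _   | yes _ = Finₚ.punchOut-cong v refl

  merge-punchIn : ∀ w → μ (punchIn v w) ≡ w
  merge-punchIn w with punchIn v w ≟ v
  ... | yes eq = ⊥-elim (Finₚ.punchInᵢ≢i v w eq)
  ... | no _   = trans (Finₚ.punchOut-cong v refl) (Finₚ.punchOut-punchIn v)

  merge-injective : ∀ a b → μ a ≡ μ b → a ≡ b ⊎ ((a ≡ u × b ≡ v) ⊎ (a ≡ v × b ≡ u))
  merge-injective a b h with a ≟ v | b ≟ v
  ... | yes refl | yes refl = inj₁ refl
  ... | yes refl | no _     = inj₂ (inj₂ (refl , sym (Finₚ.punchOut-injective {i = v} _ _ h)))
  ... | no _     | yes refl = inj₂ (inj₁ (Finₚ.punchOut-injective {i = v} _ _ h , refl))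
  ... | no _     | no _     = inj₁ (Finₚ.punchOut-injective {i = v} _ _ h)

-- K' is K with the non-loop edge e contracted, p' being the edge set p without e
module Contraction {m k : ℕ} (ends' : Fin m → Fin (suc k) × Fin (suc k)) (e : Fin m)
   (ne : proj₁ (ends' e) ≢ proj₂ (ends' e))
   (p p' : Fin m → Bool) (p'≡ : ∀ g → p' g ≡ p g ∧ not (eqF g e)) where
  private
    u v : Fin (suc k)
    u = proj₁ (ends' e)
    v = proj₂ (ends' e)
  open Merge u v ne
  private
    K K' : LGraph m
    K  = mkG (suc k) ends' p
    K' = mkG k (λ g → μ (proj₁ (ends' g)) , μ (proj₂ (ends' g))) p'
    R : Fin (suc k) → Fin (suc k) → Bool
    R  = connected K
    R' : Fin k → Fin k → Bool
    R' = connected K'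
    module WK  = Walks K
    module WK' = Walks K'

  μu~μv : R' (μ u) (μ v) ≡ true
  μu~μv = subst (λ z → R' (μ u) z ≡ true) merge-identifies (WK'.connected-refl (μ u))

  connected-merge : ∀ {a b} → R a b ≡ true → R' (μ a) (μ b) ≡ true
  connected-merge = WK.connected-ind (λ a b → R' (μ a) (μ b) ≡ true) (λ a → WK'.connected-refl (μ a))
    WK'.connected-trans step
    where
      step : ∀ {a b} → adj K a b ≡ true → R' (μ a) (μ b) ≡ true
      step {a} {b} hab with WK.adj-elim hab
      ... | g , pg , ori with eqF g e in g≟e
      ... | false = orient ori
        where
          pg' : p' g ≡ true
          pg' = trans (p'≡ g) (∧-true pg (cong not g≟e))
          orient : WK.Links g a b → R' (μ a) (μ b) ≡ true
          orient (inj₁ (x , y)) = WK'.adj⇒connected (WK'.adj-intro g pg' (cong μ x) (cong μ y))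
          orient (inj₂ (x , y)) = WK'.adj⇒connected (WK'.adj-sym (WK'.adj-intro g pg' (cong μ x) (cong μ y)))
      ... | true with eqF⇒≡ g≟e | ori
      ... | refl | inj₁ (refl , refl) = μu~μv
      ... | refl | inj₂ (refl , refl) = WK'.connected-sym μu~μv

  -- relatedness in K up to gluing together the components of u and v
  private
    InUV : Fin (suc k) → Bool
    InUV a = R a u ∨ R a v

    InUV-closed : ∀ {a b} → R a b ≡ true → InUV b ≡ true → InUV a ≡ true
    InUV-closed {a} {b} r ub with ∨-true⁻ {R b u} ub
    ... | inj₁ q = ∨-trueˡ (R a v) (WK.connected-trans r q)
    ... | inj₂ q = ∨-trueʳ (R a u) (WK.connected-trans r q)

    Glued : Fin (suc k) → Fin (suc k) → Set
    Glued a b = R a b ≡ true ⊎ (InUV a ≡ true × InUV b ≡ true)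

    glued-trans : ∀ {a b c} → Glued a b → Glued b c → Glued a c
    glued-trans (inj₁ x) (inj₁ y) = inj₁ (WK.connected-trans x y)
    glued-trans (inj₁ x) (inj₂ (ub , uc)) = inj₂ (InUV-closed x ub , uc)
    glued-trans (inj₂ (ua , ub)) (inj₁ y) = inj₂ (ua , InUV-closed (WK.connected-sym y) ub)
    glued-trans (inj₂ (ua , _)) (inj₂ (_ , uc)) = inj₂ (ua , uc)

    glued-merge : ∀ {a b} → μ a ≡ μ b → Glued a b
    glued-merge {a} {b} h with merge-injective a b h
    ... | inj₁ refl = inj₁ (WK.connected-refl a)
    ... | inj₂ (inj₁ (refl , refl)) =
      inj₂ (∨-trueˡ (R u v) (WK.connected-refl u) , ∨-trueʳ (R v u) (WK.connected-refl v))
    ... | inj₂ (inj₂ (refl , refl)) =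
      inj₂ (∨-trueʳ (R v u) (WK.connected-refl v) , ∨-trueˡ (R u v) (WK.connected-refl u))

    GluedAbove : Fin k → Fin k → Set
    GluedAbove a' b' = ∀ a b → μ a ≡ a' → μ b ≡ b' → Glued a b

  connected-unmerge : ∀ {a b} → R' (μ a) (μ b) ≡ true → Glued a b
  connected-unmerge {a} {b} h = above h a b refl refl
    where
      above : ∀ {a' b'} → R' a' b' ≡ true → GluedAbove a' b'
      above = WK'.connected-ind GluedAbove (λ _ a b ea eb → glued-merge (trans ea (sym eb)))
        (λ {_} {b'} qab qbc a c ea ec →
          glued-trans (qab a (punchIn v b') ea (merge-punchIn b')) (qbc (punchIn v b') c (merge-punchIn b') ec))
        step
        where
          step : ∀ {a' b'} → adj K' a' b' ≡ true → GluedAbove a' b'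
          step {a'} {b'} hab a b ea eb with WK'.adj-elim hab
          ... | g , pg' , link = orient link
            where
              g-joins : R (proj₁ (ends' g)) (proj₂ (ends' g)) ≡ true
              g-joins = WK.edge⇒connected g (∧-trueˡ (trans (sym (p'≡ g)) pg'))
              orient : WK'.Links g a' b' → Glued a b
              orient (inj₁ (x , y)) = glued-trans (glued-merge (trans ea (sym x)))
                (glued-trans (inj₁ g-joins) (glued-merge (trans y (sym eb))))
              orient (inj₂ (x , y)) = glued-trans (glued-merge (trans ea (sym y)))
                (glued-trans (inj₁ (WK.connected-sym g-joins)) (glued-merge (trans x (sym eb))))

  private
    module G₂ = GlueTwo R R' WK.connected-isEquivalence WK'.connected-isEquivalence
      μ (punchIn v) merge-punchIn u v μu~μv connected-merge connected-unmerge

  cc-contract-connected : R u v ≡ true → cc K ≡ cc K'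
  cc-contract-connected = G₂.classes-related

  cc-contract-disconnected : R u v ≡ false → cc K ≡ suc (cc K')
  cc-contract-disconnected = G₂.classes-unrelated

-- Each edge lowers the number of components by at most one.
vertices≤cc+edges : ∀ {m} c {n} (ends' : Fin m → Fin n × Fin n) (p : Fin m → Bool) →
  countF p ≡ c → n ≤ cc (mkG n ends' p) +ℕ c
vertices≤cc+edges zero ends' p h =
  ℕₚ.≤-reflexive (trans (sym (EdgeSets.cc-edgeless ends' p (countF≡0 p h))) (sym (ℕₚ.+-identityʳ _)))
vertices≤cc+edges (suc c) {zero} ends' p h = z≤n
vertices≤cc+edges {m} (suc c) {suc k} ends' p h with countF≡suc p h
... | e , pe = step
  where
    open EdgeSets ends'
    p₋ : Fin m → Bool
    p₋ g = p g ∧ not (eqF g e)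
    u v : Fin (suc k)
    u = proj₁ (ends' e)
    v = proj₂ (ends' e)
    ih : suc k ≤ cc (G p₋) +ℕ c
    ih = vertices≤cc+edges c ends' p₋ (ℕₚ.suc-injective (trans (sym (countF-remove p e pe)) h))
    step : suc k ≤ cc (G p) +ℕ suc c
    step with connected (G p₋) u v in u~v
    ... | true = ℕₚ.≤-trans ih (ℕₚ.≤-trans (ℕₚ.≤-reflexive (cong (_+ℕ c) (sym (cc-delete-cycleEdge p e u~v))))
                   (ℕₚ.+-monoʳ-≤ (cc (G p)) (ℕₚ.n≤1+n c)))
    ... | false = ℕₚ.≤-trans ih (ℕₚ.≤-reflexive (trans (cong (_+ℕ c) cc-split) (sym (ℕₚ.+-suc _ c))))
      where
        u≢v : u ≢ v
        u≢v eq = not-¬ u~v (subst (λ z → connected (G p₋) u z ≡ true) eq (Walks.connected-refl (G p₋) u))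
        module C₋ = Contraction ends' e u≢v p₋ p₋
          (λ g → sym (trans (Boolₚ.∧-assoc (p g) _ _) (cong (p g ∧_) (Boolₚ.∧-idem _))))
        module C = Contraction ends' e u≢v p p₋ (λ g → refl)
        cc-split : cc (G p₋) ≡ suc (cc (G p))
        cc-split = trans (C₋.cc-contract-disconnected u~v)
          (cong suc (sym (C.cc-contract-connected (Walks.edge⇒connected (G p) e pe))))

∧-not-agree : ∀ p s s' d → (d ≡ false → s' ≡ s) → (p ∧ not d) ∧ s' ≡ (p ∧ s) ∧ not d
∧-not-agree p s s' true  h rewrite Boolₚ.∧-zeroʳ p | Boolₚ.∧-zeroʳ (p ∧ s) = refl
∧-not-agree p s s' false h rewrite h refl | Boolₚ.∧-identityʳ p | Boolₚ.∧-identityʳ (p ∧ s) = refl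

∧-not-redundant : ∀ p s d → (d ≡ true → s ≡ false) → p ∧ s ≡ (p ∧ not d) ∧ s
∧-not-redundant p s true  h rewrite h refl | Boolₚ.∧-zeroʳ p = refl
∧-not-redundant p s false h rewrite Boolₚ.∧-identityʳ p = refl

module ComponentsAt {m k} (ends' : Fin m → Fin (suc k) × Fin (suc k)) (pr : Fin m → Bool) (e : Fin m) where
  open EdgeSets ends'
  H : LGraph m
  H = mkG (suc k) ends' pr
  private
    u v : Fin (suc k)
    u = proj₁ (ends' e)
    v = proj₂ (ends' e)

  cc-restrict-delete : ∀ S → S e ≡ false → cc (restrict H S) ≡ cc (restrict (delete e H) S)
  cc-restrict-delete S se = cc-cong λ g →
    ∧-not-redundant (pr g) (S g) (eqF g e) (λ eg → subst (λ z → S z ≡ false) (sym (eqF⇒≡ eg)) se)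

  cc-delete-nonIsthmus : (cc H <ᵇ cc (delete e H)) ≡ false → cc (delete e H) ≡ cc H
  cc-delete-nonIsthmus st = ℕₚ.≤-antisym (ℕₚ.≮⇒≥ λ lt → not-¬ st (<⇒<ᵇ lt)) (cc-anti (λ g q → ∧-trueˡ q))

  isthmus-separates : (cc H <ᵇ cc (delete e H)) ≡ true → ∀ S → (∀ g → S g ≡ true → pr g ≡ true) →
    S e ≡ false → connected (restrict H S) u v ≡ false
  isthmus-separates ist S S⊆pr se = ≢true⇒false λ c → not-¬ u≁v (connected-mono S⊆H-e c)
    where
      u≁v : connected (delete e H) u v ≡ false
      u≁v = ≢true⇒false λ c → ℕₚ.<-irrefl (cc-delete-cycleEdge pr e c) (<ᵇ⇒< ist)
      S⊆H-e : ∀ g → pr g ∧ S g ≡ true → pr g ∧ not (eqF g e) ≡ true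
      S⊆H-e g q = ∧-true (∧-trueˡ q)
        (cong not (≢⇒eqF λ eq → not-¬ se (subst (λ z → S z ≡ true) eq (∧-trueʳ q))))

  module Loop (u≡v : u ≡ v) where
    private
      cc-delete-loop : ∀ p → cc (G p) ≡ cc (G (λ g → p g ∧ not (eqF g e)))
      cc-delete-loop p = cc-delete-cycleEdge p e
        (subst (λ z → connected (G (λ g → p g ∧ not (eqF g e))) u z ≡ true) u≡v
               (Walks.connected-refl (G (λ g → p g ∧ not (eqF g e))) u))

    cc-delete : cc H ≡ cc (delete e H)
    cc-delete = cc-delete-loop pr

    cc-restrict : ∀ S S' → (∀ g → eqF g e ≡ false → S' g ≡ S g) →
      cc (restrict H S) ≡ cc (restrict (delete e H) S')
    cc-restrict S S' agree = trans (cc-delete-loop (λ g → pr g ∧ S g))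
      (cc-cong λ g → sym (∧-not-agree (pr g) (S g) (S' g) (eqF g e) (agree g)))

  module NonLoop (u≢v : u ≢ v) where
    Hc : LGraph m
    Hc = contract e ends' pr u≢v

    cc-contract : pr e ≡ true → cc H ≡ cc Hc
    cc-contract pe = C.cc-contract-connected (Walks.edge⇒connected H e pe)
      where module C = Contraction ends' e u≢v pr (λ g → pr g ∧ not (eqF g e)) (λ g → refl)

    module Restricted (S S' : Subgraph m) (agree : ∀ g → eqF g e ≡ false → S' g ≡ S g) where
      private
        module C = Contraction ends' e u≢v (λ g → pr g ∧ S g) (λ g → (pr g ∧ not (eqF g e)) ∧ S' g)
          (λ g → ∧-not-agree (pr g) (S g) (S' g) (eqF g e) (agree g))

      cc-restrict-contract : pr e ≡ true → S e ≡ true → cc (restrict H S) ≡ cc (restrict Hc S')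
      cc-restrict-contract pe se = C.cc-contract-connected (Walks.edge⇒connected (restrict H S) e (∧-true pe se))

      cc-restrict-contract-separated : connected (restrict H S) u v ≡ false →
        cc (restrict H S) ≡ suc (cc (restrict Hc S'))
      cc-restrict-contract-separated = C.cc-contract-disconnected

sumSubsets : ∀ {m} → (Subgraph m → ℤ) → ℤ
sumSubsets {m} F = sumℤ (map F (allSubsets m))

Extensional : ∀ {m} → (Subgraph m → ℤ) → Set
Extensional {m} F = ∀ (S S' : Subgraph m) → (∀ g → S g ≡ S' g) → F S ≡ F S'

sum-map-cong : ∀ {A : Set} (xs : List A) {F G : A → ℤ} → (∀ x → F x ≡ G x) →
  sumℤ (map F xs) ≡ sumℤ (map G xs)
sum-map-cong []       h = refl
sum-map-cong (x ∷ xs) h = cong₂ _+ℤ_ (h x) (sum-map-cong xs h)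

sum-map-+ : ∀ {A : Set} (xs : List A) (F G : A → ℤ) →
  sumℤ (map (λ x → F x +ℤ G x) xs) ≡ sumℤ (map F xs) +ℤ sumℤ (map G xs)
sum-map-+ []       F G = refl
sum-map-+ (x ∷ xs) F G = trans (cong (F x +ℤ G x +ℤ_) (sum-map-+ xs F G)) (ℤ+.interchange (F x) (G x) _ _)

sum-map-* : ∀ {A : Set} (xs : List A) (c : ℤ) (F : A → ℤ) →
  sumℤ (map (λ x → c * F x) xs) ≡ c * sumℤ (map F xs)
sum-map-* []       c F = sym (ℤₚ.*-zeroʳ c)
sum-map-* (x ∷ xs) c F = trans (cong (c * F x +ℤ_) (sum-map-* xs c F)) (sym (ℤₚ.*-distribˡ-+ c (F x) _))

sum-map-zero : ∀ {A : Set} (xs : List A) → sumℤ (map (λ _ → + 0) xs) ≡ + 0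
sum-map-zero []       = refl
sum-map-zero (_ ∷ xs) = trans (ℤₚ.+-identityˡ _) (sum-map-zero xs)

sumSubsets-cong : ∀ {m} {F G : Subgraph m → ℤ} → (∀ S → F S ≡ G S) → sumSubsets F ≡ sumSubsets G
sumSubsets-cong {m} = sum-map-cong (allSubsets m)

sumSubsets-+ : ∀ {m} (F G : Subgraph m → ℤ) → sumSubsets (λ S → F S +ℤ G S) ≡ sumSubsets F +ℤ sumSubsets G
sumSubsets-+ {m} = sum-map-+ (allSubsets m)

sumSubsets-* : ∀ {m} (c : ℤ) (F : Subgraph m → ℤ) → sumSubsets (λ S → c * F S) ≡ c * sumSubsets F
sumSubsets-* {m} = sum-map-* (allSubsets m)

sumSubsets-zero : ∀ {m} → sumSubsets {m} (λ _ → + 0) ≡ + 0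
sumSubsets-zero {m} = sum-map-zero (allSubsets m)

extend : ∀ {m} → Bool → Subgraph m → Subgraph (suc m)
extend b S zero    = b
extend b S (suc i) = S i

-- allSubsets lists the two extensions of each subset as anonymous pattern lambdas,
-- which are only pointwise equal to extend false S and extend true S.
record TwoExtensions {m} (S : Subgraph m) (l : List (Subgraph (suc m))) : Set where
  field
    without with' : Subgraph (suc m)
    listed        : l ≡ without ∷ with' ∷ []
    without≗      : ∀ g → without g ≡ extend false S g
    with≗         : ∀ g → with' g ≡ extend true S g

sumSubsets-suc : ∀ {m} (F : Subgraph (suc m) → ℤ) → Extensional F →
  sumSubsets F ≡ sumSubsets (λ S → F (extend false S) +ℤ F (extend true S))
sumSubsets-suc {m} F ext = go _ (λ S → record { without = _ ; with' = _ ; listed = refl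
    ; without≗ = λ { zero → refl ; (suc i) → refl } ; with≗ = λ { zero → refl ; (suc i) → refl } })
  (allSubsets m)
  where
    go : (g : Subgraph m → List (Subgraph (suc m))) → (∀ S → TwoExtensions S (g S)) → ∀ xs →
      sumℤ (map F (concatMap g xs)) ≡ sumℤ (map (λ S → F (extend false S) +ℤ F (extend true S)) xs)
    go g two [] = refl
    go g two (x ∷ xs) with g x | TwoExtensions.listed (two x)
    ... | _ | refl = trans (cong (λ z → F a +ℤ (F b +ℤ z)) (go g two xs))
      (trans (sym (ℤₚ.+-assoc (F a) _ _))
       (cong₂ (λ p q → p +ℤ q +ℤ sumℤ (map (λ S → F (extend false S) +ℤ F (extend true S)) xs))
              (ext _ _ (TwoExtensions.without≗ (two x))) (ext _ _ (TwoExtensions.with≗ (two x)))))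
      where
        a b : Subgraph (suc m)
        a = TwoExtensions.without (two x)
        b = TwoExtensions.with' (two x)

add : ∀ {m} → Subgraph m → Fin m → Subgraph m
add S e g = S g ∨ eqF g e

unless : Bool → ℤ → ℤ
unless b X = if b then + 0 else X

private
  unless-cong : ∀ {b b' X X'} → b ≡ b' → X ≡ X' → unless b X ≡ unless b' X'
  unless-cong refl refl = refl

  ext-unless : ∀ {m} (e : Fin m) (F : Subgraph m → ℤ) → Extensional F → Extensional (λ S → unless (S e) (F S))
  ext-unless e F ext S S' h = unless-cong (h e) (ext S S' h)

  ext-add : ∀ {m} (e : Fin m) (F : Subgraph m → ℤ) → Extensional F → Extensional (λ S → unless (S e) (F (add S e)))
  ext-add e F ext S S' h = unless-cong (h e) (ext _ _ λ g → cong (_∨ eqF g e) (h g))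

  ext-extend : ∀ {m} b (F : Subgraph (suc m) → ℤ) → Extensional F → Extensional (λ S → F (extend b S))
  ext-extend b F ext S S' h = ext _ _ λ { zero → refl ; (suc i) → h i }

sumSubsets-split : ∀ {m} (e : Fin m) (F : Subgraph m → ℤ) → Extensional F →
  sumSubsets F ≡ sumSubsets (λ S → unless (S e) (F S)) +ℤ sumSubsets (λ S → unless (S e) (F (add S e)))
sumSubsets-split {suc m} zero F ext =
  trans (sumSubsets-suc F ext) (trans (sumSubsets-+ (λ S → F (extend false S)) (λ S → F (extend true S)))
    (sym (cong₂ _+ℤ_
      (trans (sumSubsets-suc (λ S → unless (S zero) (F S)) (ext-unless zero F ext))
        (sumSubsets-cong λ S → ℤₚ.+-identityʳ (F (extend false S))))
      (trans (sumSubsets-suc (λ S → unless (S zero) (F (add S zero))) (ext-add zero F ext))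
        (sumSubsets-cong λ S → trans (ℤₚ.+-identityʳ (F (add (extend false S) zero)))
        (ext _ (extend true S) λ { zero → refl ; (suc i) → Boolₚ.∨-identityʳ (S i) }))))))
sumSubsets-split {suc m} (suc e) F ext =
  trans (sumSubsets-suc F ext) (trans (sumSubsets-+ F₀ F₁)
   (trans (cong₂ _+ℤ_ (sumSubsets-split e F₀ (ext-extend false F ext)) (sumSubsets-split e F₁ (ext-extend true F ext)))
   (trans (ℤ+.interchange (sumSubsets A₀) (sumSubsets B₀) (sumSubsets A₁) (sumSubsets B₁))
   (sym (cong₂ _+ℤ_
     (trans (sumSubsets-suc (λ S → unless (S (suc e)) (F S)) (ext-unless (suc e) F ext)) (sumSubsets-+ A₀ A₁))
     (trans (sumSubsets-suc (λ S → unless (S (suc e)) (F (add S (suc e)))) (ext-add (suc e) F ext))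
       (trans (sumSubsets-cong λ S → cong₂ _+ℤ_ (add-extend false S) (add-extend true S)) (sumSubsets-+ B₀ B₁))))))))
  where
    F₀ F₁ A₀ A₁ B₀ B₁ : Subgraph m → ℤ
    F₀ S = F (extend false S)
    F₁ S = F (extend true S)
    A₀ S = unless (S e) (F₀ S)
    A₁ S = unless (S e) (F₁ S)
    B₀ S = unless (S e) (F₀ (add S e))
    B₁ S = unless (S e) (F₁ (add S e))
    add-extend : ∀ b S → unless (S e) (F (add (extend b S) (suc e))) ≡ unless (S e) (F (extend b (add S e)))
    add-extend b S = cong (unless (S e)) (ext _ _ λ { zero → Boolₚ.∨-identityʳ b ; (suc i) → cong (S i ∨_) (eqF-suc i e) })

-- Δ is a decision tree for the edge set P: along every root-to-leaf path
-- the labels enumerate P exactly once.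
IsDecisionTreeFor : ∀ {m} → (Fin m → Bool) → BTree m → Set
IsDecisionTreeFor P leaf         = ∀ g → P g ≡ false
IsDecisionTreeFor P (node e l r) =
  P e ≡ true × IsDecisionTreeFor (λ g → P g ∧ not (eqF g e)) l × IsDecisionTreeFor (λ g → P g ∧ not (eqF g e)) r

InTree : ∀ {m} → Fin m → BTree m → Set
InTree g leaf         = ⊥
InTree g (node e l r) = g ≡ e ⊎ (InTree g l ⊎ InTree g r)

InTree⇒present : ∀ {m} {P : Fin m → Bool} Δ → IsDecisionTreeFor P Δ → ∀ g → InTree g Δ → P g ≡ true
InTree⇒present (node e l r) (pe , _ , _) g (inj₁ refl)     = pe
InTree⇒present (node e l r) (_ , dl , _) g (inj₂ (inj₁ i)) = ∧-trueˡ (InTree⇒present l dl g i)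
InTree⇒present (node e l r) (_ , _ , dr) g (inj₂ (inj₂ i)) = ∧-trueˡ (InTree⇒present r dr g i)

root∉subtree : ∀ {m} {P : Fin m → Bool} e Δ → IsDecisionTreeFor (λ g → P g ∧ not (eqF g e)) Δ → ¬ InTree e Δ
root∉subtree e Δ d i = not-¬ (cong not (eqF-refl e)) (∧-trueʳ (InTree⇒present Δ d e i))

occ : ∀ {m} → Fin m → List (Fin m) → ℕ
occ g []       = 0
occ g (x ∷ xs) = ind (eqF x g) +ℕ occ g xs

occ-↭ : ∀ {m} (g : Fin m) {xs ys} → xs ↭ ys → occ g xs ≡ occ g ys
occ-↭ g Perm.refl        = refl
occ-↭ g (Perm.prep x p)  = cong (ind (eqF x g) +ℕ_) (occ-↭ g p)
occ-↭ g (Perm.swap {ys = ys} x y p) =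
  trans (cong (λ z → ind (eqF x g) +ℕ (ind (eqF y g) +ℕ z)) (occ-↭ g p))
        (ℕ+.x∙yz≈y∙xz (ind (eqF x g)) (ind (eqF y g)) (occ g ys))
occ-↭ g (Perm.trans p q) = trans (occ-↭ g p) (occ-↭ g q)

occ-allFinL : ∀ m (g : Fin m) → occ g (allFinL m) ≡ 1
occ-allFinL (suc m) zero    = cong suc (occ-zero (allFinL m))
  where
    occ-zero : ∀ (xs : List (Fin m)) → occ zero (map suc xs) ≡ 0
    occ-zero []       = refl
    occ-zero (x ∷ xs) = occ-zero xs
occ-allFinL (suc m) (suc g) = trans (occ-suc (allFinL m)) (occ-allFinL m g)
  where
    occ-suc : ∀ xs → occ (suc g) (map suc xs) ≡ occ g xs
    occ-suc []       = refl
    occ-suc (x ∷ xs) = cong₂ _+ℕ_ (cong ind (eqF-suc x g)) (occ-suc xs)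

Enumerates : ∀ {m} → (Fin m → Bool) → List (Fin m) → Set
Enumerates P p = ∀ g → occ g p ≡ ind (P g)

Enumerates-tail : ∀ {m} (P : Fin m → Bool) e {p} → Enumerates P (e ∷ p) → Enumerates (λ g → P g ∧ not (eqF g e)) p
Enumerates-tail P e {p} h g with eqF g e in g≟e
... | false = trans (subst (λ b → ind b +ℕ occ g p ≡ ind (P g)) (trans (eqF-sym e g) g≟e) (h g))
                (cong ind (sym (Boolₚ.∧-identityʳ (P g))))
... | true with eqF⇒≡ g≟e
... | refl = trans (ℕₚ.suc-injective (trans once (cong ind (present (P g) once))))
                   (cong ind (sym (Boolₚ.∧-zeroʳ (P g))))
  where
    once : suc (occ g p) ≡ ind (P g)
    once = subst (λ b → ind b +ℕ occ g p ≡ ind (P g)) (eqF-refl g) (h g)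
    present : ∀ b → suc (occ g p) ≡ ind b → b ≡ true
    present true  _  = refl
    present false eq = ⊥-elim (ℕₚ.1+n≢0 eq)

head-of-path : ∀ {m} {Q : List (Fin m) → Set} (Δ : BTree m) → All Q (paths Δ) → Σ (List (Fin m)) Q
head-of-path leaf         (q ∷ _) = [] , q
head-of-path (node e l r) a with head-of-path l (Allₚ.++⁻ˡ (paths l) (Allₚ.map⁻ a))
... | p , q = e ∷ p , q

paths-enumerate⇒IsDecisionTreeFor : ∀ {m} (P : Fin m → Bool) (Δ : BTree m) →
  All (Enumerates P) (paths Δ) → IsDecisionTreeFor P Δ
paths-enumerate⇒IsDecisionTreeFor P leaf (h ∷ _) g = ind≡0 (sym (h g))
  where
    ind≡0 : ∀ {b} → ind b ≡ 0 → b ≡ false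
    ind≡0 {false} _ = refl
paths-enumerate⇒IsDecisionTreeFor P (node e l r) a =
  pe , paths-enumerate⇒IsDecisionTreeFor _ l (All.map (λ {p} → Enumerates-tail P e {p}) al)
     , paths-enumerate⇒IsDecisionTreeFor _ r (All.map (λ {p} → Enumerates-tail P e {p}) ar)
  where
    a' : All (λ p → Enumerates P (e ∷ p)) (paths l ++ paths r)
    a' = Allₚ.map⁻ a
    al : All (λ p → Enumerates P (e ∷ p)) (paths l)
    al = Allₚ.++⁻ˡ (paths l) a'
    ar : All (λ p → Enumerates P (e ∷ p)) (paths r)
    ar = Allₚ.++⁻ʳ (paths l) a'
    ind≡suc : ∀ {b n} → ind b ≡ suc n → b ≡ true
    ind≡suc {true} _ = refl
    pe : P e ≡ true
    pe with head-of-path {Q = λ p → Enumerates P (e ∷ p)} l al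
    ... | p , q = ind≡suc (trans (sym (q e)) (cong (λ b → ind b +ℕ occ e p) (eqF-refl e)))

IsDecisionTree⇒IsDecisionTreeFor : ∀ {m} (Δ : BTree m) → IsDecisionTree Δ → IsDecisionTreeFor (λ _ → true) Δ
IsDecisionTree⇒IsDecisionTreeFor {m} Δ h = paths-enumerate⇒IsDecisionTreeFor _ Δ
  (All.map (λ p↭ g → trans (occ-↭ g p↭) (occ-allFinL m g)) h)

assign-local : ∀ {m} (Δ : BTree m) (H : LGraph m) (S S' : Subgraph m) →
  (∀ g → InTree g Δ → S g ≡ S' g) → assign S H Δ ≡ assign S' H Δ
assign-local leaf H S S' h = refl
assign-local (node e l r) (mkG zero ends' pr) S S' h with proj₁ (ends' e)
... | ()
assign-local (node e l r) (mkG (suc k) ends' pr) S S' h with proj₁ (ends' e) ≟ proj₂ (ends' e)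
... | yes _ = cong ((e , L) ∷_) (assign-local l _ S S' (λ g i → h g (inj₂ (inj₁ i))))
... | no ne with cc (mkG (suc k) ends' pr) <ᵇ cc (delete e (mkG (suc k) ends' pr))
...   | true = cong ((e , I) ∷_) (assign-local r _ S S' (λ g i → h g (inj₂ (inj₂ i))))
...   | false with S e | S' e | h e (inj₁ refl)
...     | true  | true  | refl = cong ((e , Si) ∷_) (assign-local r _ S S' (λ g i → h g (inj₂ (inj₂ i))))
...     | false | false | refl = cong ((e , Se) ∷_) (assign-local l _ S S' (λ g i → h g (inj₂ (inj₁ i))))

assign-labels : ∀ {m} (Δ : BTree m) (H : LGraph m) (S : Subgraph m) →
  All (λ x → InTree (proj₁ x) Δ) (assign S H Δ)
assign-labels leaf H S = []
assign-labels (node e l r) (mkG zero ends' pr) S with proj₁ (ends' e)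
... | ()
assign-labels (node e l r) (mkG (suc k) ends' pr) S with proj₁ (ends' e) ≟ proj₂ (ends' e)
... | yes _ = inj₁ refl ∷ All.map (λ i → inj₂ (inj₁ i)) (assign-labels l _ S)
... | no ne with cc (mkG (suc k) ends' pr) <ᵇ cc (delete e (mkG (suc k) ends' pr))
...   | true = inj₁ refl ∷ All.map (λ i → inj₂ (inj₂ i)) (assign-labels r _ S)
...   | false with S e
...     | true  = inj₁ refl ∷ All.map (λ i → inj₂ (inj₂ i)) (assign-labels r _ S)
...     | false = inj₁ refl ∷ All.map (λ i → inj₂ (inj₁ i)) (assign-labels l _ S)

isActive-local : ∀ {m} (H : LGraph m) (Δ : BTree m) (S S' : Subgraph m) →
  (∀ g → InTree g Δ → S g ≡ S' g) → ∀ g → isActive H Δ S g ≡ isActive H Δ S' g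
isActive-local H Δ S S' h g =
  cong (anyL (λ p → eqF (proj₁ p) g ∧ isActiveType (proj₂ p))) (assign-local Δ H S S' h)

isActive-∉ : ∀ {m} (H : LGraph m) (Δ : BTree m) (S : Subgraph m) g → ¬ InTree g Δ → isActive H Δ S g ≡ false
isActive-∉ H Δ S g g∉Δ = go (assign S H Δ) (assign-labels Δ H S)
  where
    go : ∀ xs → All (λ x → InTree (proj₁ x) Δ) xs → anyL (λ p → eqF (proj₁ p) g ∧ isActiveType (proj₂ p)) xs ≡ false
    go []             []       = refl
    go ((h , t) ∷ xs) (p ∷ ps) rewrite go xs ps
      | ≢⇒eqF {i = h} {j = g} (λ eq → g∉Δ (subst (λ z → InTree z Δ) eq p)) = refl

module AssignAt {m k} (ends' : Fin m → Fin (suc k) × Fin (suc k)) (pr : Fin m → Bool) (e : Fin m) (l r : BTree m) where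
  private
    H : LGraph m
    H = mkG (suc k) ends' pr

  assign-loop : ∀ S → proj₁ (ends' e) ≡ proj₂ (ends' e) → assign S H (node e l r) ≡ (e , L) ∷ assign S (delete e H) l
  assign-loop S eq with proj₁ (ends' e) ≟ proj₂ (ends' e)
  ... | yes _ = refl
  ... | no ne = ⊥-elim (ne eq)

  assign-isthmus : ∀ S {ne} → (proj₁ (ends' e) ≟ proj₂ (ends' e)) ≡ no ne → (cc H <ᵇ cc (delete e H)) ≡ true →
    assign S H (node e l r) ≡ (e , I) ∷ assign S (contract e ends' pr ne) r
  assign-isthmus S nl ist with proj₁ (ends' e) ≟ proj₂ (ends' e) | nl
  ... | _ | refl with cc H <ᵇ cc (delete e H) | ist
  ... | _ | refl = refl

  assign-standard∉ : ∀ S {ne} → (proj₁ (ends' e) ≟ proj₂ (ends' e)) ≡ no ne → (cc H <ᵇ cc (delete e H)) ≡ false →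
    S e ≡ false → assign S H (node e l r) ≡ (e , Se) ∷ assign S (delete e H) l
  assign-standard∉ S nl std se with proj₁ (ends' e) ≟ proj₂ (ends' e) | nl
  ... | _ | refl with cc H <ᵇ cc (delete e H) | std
  ... | _ | refl with S e | se
  ... | _ | refl = refl

  assign-standard∈ : ∀ S {ne} → (proj₁ (ends' e) ≟ proj₂ (ends' e)) ≡ no ne → (cc H <ᵇ cc (delete e H)) ≡ false →
    S e ≡ true → assign S H (node e l r) ≡ (e , Si) ∷ assign S (contract e ends' pr ne) r
  assign-standard∈ S nl std se with proj₁ (ends' e) ≟ proj₂ (ends' e) | nl
  ... | _ | refl with cc H <ᵇ cc (delete e H) | std
  ... | _ | refl with S e | se
  ... | _ | refl = refl

private
  countF-head : ∀ {m} (X Y : Fin m → Bool) (e : Fin m) b → Y e ≡ false →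
    countF (λ g → X g ∧ ((eqF e g ∧ b) ∨ Y g)) ≡ ind (X e ∧ b) +ℕ countF (λ g → X g ∧ Y g)
  countF-head X Y e b ye = begin
      countF (λ g → X g ∧ ((eqF e g ∧ b) ∨ Y g))
    ≡⟨ countF-split _ e ⟩
      ind (X e ∧ ((eqF e e ∧ b) ∨ Y e)) +ℕ countF (λ g → (X g ∧ ((eqF e g ∧ b) ∨ Y g)) ∧ not (eqF g e))
    ≡⟨ cong₂ _+ℕ_ (cong (λ z → ind (X e ∧ z))
                     (trans (cong₂ (λ p q → (p ∧ b) ∨ q) (eqF-refl e) ye) (Boolₚ.∨-identityʳ b)))
                  (countF-cong off-e) ⟩
      ind (X e ∧ b) +ℕ countF (λ g → (X g ∧ Y g) ∧ not (eqF g e))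
    ≡⟨ cong (λ z → ind (X e ∧ b) +ℕ z) (sym (trans (countF-split (λ g → X g ∧ Y g) e)
         (cong (λ z → ind z +ℕ countF (λ g → (X g ∧ Y g) ∧ not (eqF g e)))
               (trans (cong (X e ∧_) ye) (Boolₚ.∧-zeroʳ (X e)))))) ⟩
      ind (X e ∧ b) +ℕ countF (λ g → X g ∧ Y g)
    ∎
    where
      open ≡-Reasoning
      off-e : ∀ g → (X g ∧ ((eqF e g ∧ b) ∨ Y g)) ∧ not (eqF g e) ≡ (X g ∧ Y g) ∧ not (eqF g e)
      off-e g with eqF g e in g≟e
      ... | true  rewrite Boolₚ.∧-zeroʳ (X g ∧ ((eqF e g ∧ b) ∨ Y g)) | Boolₚ.∧-zeroʳ (X g ∧ Y g) = refl
      ... | false rewrite eqF-sym e g | g≟e = refl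

numIntActive-node : ∀ {m} (H H' : LGraph m) (e : Fin m) (l r sub : BTree m) (T : Subgraph m) t →
  assign T H (node e l r) ≡ (e , t) ∷ assign T H' sub → ¬ InTree e sub →
  numIntActive H (node e l r) T ≡ ind (T e ∧ isActiveType t) +ℕ numIntActive H' sub T
numIntActive-node H H' e l r sub T t eq e∉sub rewrite eq =
  countF-head T (isActive H' sub T) e (isActiveType t) (isActive-∉ H' sub T e e∉sub)

numExtActive-node : ∀ {m} (H H' : LGraph m) (e : Fin m) (l r sub : BTree m) (T : Subgraph m) t →
  assign T H (node e l r) ≡ (e , t) ∷ assign T H' sub → ¬ InTree e sub →
  numExtActive H (node e l r) T ≡ ind (not (T e) ∧ isActiveType t) +ℕ numExtActive H' sub T
numExtActive-node H H' e l r sub T t eq e∉sub rewrite eq =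
  countF-head (λ g → not (T g)) (isActive H' sub T) e (isActiveType t) (isActive-∉ H' sub T e e∉sub)

-- A graph H has edge set pres H ⊆ Fin m; its spanning subgraphs are the S with S ⊆ᵇ pres H.

_⊆ᵇ_ : ∀ {m} → Subgraph m → (Fin m → Bool) → Bool
S ⊆ᵇ P = not (anyF λ g → S g ∧ not (P g))

⊆ᵇ⇒ : ∀ {m} {S P : Fin m → Bool} → (S ⊆ᵇ P) ≡ true → ∀ g → S g ≡ true → P g ≡ true
⊆ᵇ⇒ {S = S} {P} h g sg = not-false (trans (cong (λ z → z ∧ not (P g)) (sym sg))
  (anyF-false (λ g → S g ∧ not (P g)) (not-true h) g))

⊆ᵇ-cong : ∀ {m} {S S' P : Fin m → Bool} → (∀ g → S g ≡ S' g) → (S ⊆ᵇ P) ≡ (S' ⊆ᵇ P)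
⊆ᵇ-cong h = cong not (anyF-cong λ g → cong (λ a → a ∧ not _) (h g))

⊆ᵇ-all : ∀ {m} (S : Subgraph m) → (S ⊆ᵇ (λ _ → true)) ≡ true
⊆ᵇ-all S = cong not (anyF-none (λ g → S g ∧ false) (λ g → Boolₚ.∧-zeroʳ (S g)))

module Without {m} (P : Fin m → Bool) (e : Fin m) where
  P₋ : Fin m → Bool
  P₋ g = P g ∧ not (eqF g e)

  ⊆ᵇ-without-∈ : ∀ {S} → S e ≡ true → (S ⊆ᵇ P₋) ≡ false
  ⊆ᵇ-without-∈ {S} se = cong not (anyF-intro (λ g → S g ∧ not (P₋ g)) e
    (∧-true se (trans (cong (λ z → not (P e ∧ not z)) (eqF-refl e)) (cong not (Boolₚ.∧-zeroʳ (P e))))))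

  ⊆ᵇ-without-∉ : ∀ {S} → S e ≡ false → (S ⊆ᵇ P) ≡ (S ⊆ᵇ P₋)
  ⊆ᵇ-without-∉ {S} se = cong not (anyF-cong pointwise)
    where
      pointwise : ∀ g → S g ∧ not (P g) ≡ S g ∧ not (P g ∧ not (eqF g e))
      pointwise g with eqF g e in g≟e
      ... | true rewrite eqF⇒≡ g≟e | se = refl
      ... | false rewrite Boolₚ.∧-identityʳ (P g) = refl

  add-⊆ᵇ : P e ≡ true → ∀ {S} → S e ≡ false → (add S e ⊆ᵇ P) ≡ (S ⊆ᵇ P₋)
  add-⊆ᵇ pe {S} se = cong not (anyF-cong pointwise)
    where
      pointwise : ∀ g → (S g ∨ eqF g e) ∧ not (P g) ≡ S g ∧ not (P g ∧ not (eqF g e))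
      pointwise g with eqF g e in g≟e
      ... | true rewrite eqF⇒≡ g≟e | se | pe = refl
      ... | false rewrite Boolₚ.∧-identityʳ (P g) | Boolₚ.∨-identityʳ (S g) = refl

  add-off : ∀ S g → eqF g e ≡ false → add S e g ≡ S g
  add-off S g g≟e rewrite g≟e = Boolₚ.∨-identityʳ (S g)

  add-self : ∀ S → add S e e ≡ true
  add-self S rewrite eqF-refl e = Boolₚ.∨-zeroʳ (S e)

  size-add : ∀ {S} → S e ≡ false → size (add S e) ≡ suc (size S)
  size-add {S} se = trans (countF-remove (add S e) e (add-self S)) (cong suc (countF-cong pointwise))
    where
      pointwise : ∀ g → add S e g ∧ not (eqF g e) ≡ S g
      pointwise g with eqF g e in g≟e
      ... | true rewrite eqF⇒≡ g≟e | se = refl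
      ... | false rewrite Boolₚ.∨-identityʳ (S g) = Boolₚ.∧-identityʳ (S g)

cc≤cc-restrict : ∀ {m} (H : LGraph m) S → cc H ≤ cc (restrict H S)
cc≤cc-restrict H S = EdgeSets.cc-anti (ends H) {p₁ = λ g → pres H g ∧ S g} {p₂ = pres H} (λ g q → ∧-trueˡ q)

vertices≤cc+size : ∀ {m n} (ends' : Fin m → Fin n × Fin n) (P S : Fin m → Bool) → (∀ g → S g ≡ true → P g ≡ true) →
  n ≤ cc (mkG n ends' (λ g → P g ∧ S g)) +ℕ size S
vertices≤cc+size ends' P S S⊆P = subst (λ z → _ ≤ cc (mkG _ ends' (λ g → P g ∧ S g)) +ℕ z) (countF-cong P∧S≡S)
  (vertices≤cc+edges _ ends' (λ g → P g ∧ S g) refl)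
  where
    P∧S≡S : ∀ g → P g ∧ S g ≡ S g
    P∧S≡S g with S g in sg
    ... | true  = trans (Boolₚ.∧-identityʳ (P g)) (S⊆P g sg)
    ... | false = Boolₚ.∧-zeroʳ (P g)

cc-restrict-cong : ∀ {m} (H : LGraph m) S S' → (∀ g → S g ≡ S' g) → cc (restrict H S) ≡ cc (restrict H S')
cc-restrict-cong H S S' h = EdgeSets.cc-cong (ends H) (λ g → cong (pres H g ∧_) (h g))

cycl-cong : ∀ {m} (H : LGraph m) S S' → (∀ g → S g ≡ S' g) → cycl H S ≡ cycl H S'
cycl-cong H S S' h = cong (_∸ nV H) (cong₂ _+ℕ_ (cc-restrict-cong H S S' h) (countF-cong h))

isSpanningTree-cong : ∀ {m} (H : LGraph m) S S' → (∀ g → S g ≡ S' g) → isSpanningTree H S ≡ isSpanningTree H S'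
isSpanningTree-cong H S S' h = cong₂ (λ a b → (a ℕ.≡ᵇ 1) ∧ (b ℕ.≡ᵇ 0)) (cc-restrict-cong H S S' h) (cycl-cong H S S' h)

¬isSpanningTree-cc : ∀ {m} (H : LGraph m) S → 1 < cc (restrict H S) → isSpanningTree H S ≡ false
¬isSpanningTree-cc H S = go (cc (restrict H S)) refl
  where
    go : ∀ c → cc (restrict H S) ≡ c → 1 < c → isSpanningTree H S ≡ false
    go (suc zero)    _  (s≤s ())
    go (suc (suc j)) eq _ = cong (λ z → (z ℕ.≡ᵇ 1) ∧ (cycl H S ℕ.≡ᵇ 0)) eq

¬isSpanningTree-cycl : ∀ {m} (H : LGraph m) S → 0 < cycl H S → isSpanningTree H S ≡ false
¬isSpanningTree-cycl H S = go (cycl H S) refl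
  where
    go : ∀ c → cycl H S ≡ c → 0 < c → isSpanningTree H S ≡ false
    go (suc j) eq _ = trans (cong (λ z → (cc (restrict H S) ℕ.≡ᵇ 1) ∧ (z ℕ.≡ᵇ 0)) eq) (Boolₚ.∧-zeroʳ _)

numIntActive-cong : ∀ {m} (H : LGraph m) Δ S S' → (∀ g → S g ≡ S' g) → numIntActive H Δ S ≡ numIntActive H Δ S'
numIntActive-cong H Δ S S' h = countF-cong λ g → cong₂ _∧_ (h g) (isActive-local H Δ S S' (λ g _ → h g) g)

numExtActive-cong : ∀ {m} (H : LGraph m) Δ S S' → (∀ g → S g ≡ S' g) → numExtActive H Δ S ≡ numExtActive H Δ S'
numExtActive-cong H Δ S S' h = countF-cong λ g → cong₂ _∧_ (cong not (h g)) (isActive-local H Δ S S' (λ g _ → h g) g)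

-- Deletion and contraction on both sides of the identity

t+[a-1]t≡at : ∀ a t → t +ℤ (a - + 1) * t ≡ a * t
t+[a-1]t≡at = solve-∀

[a-1]t+t≡at : ∀ a t → (a - + 1) * t +ℤ t ≡ a * t
[a-1]t+t≡at = solve-∀

module Expansions (x y : ℤ) where
  monomial : ℕ → ℕ → ℤ
  monomial i j = ((x - + 1) ^ i) * ((y - + 1) ^ j)

  monomial-sucˡ : ∀ i j → monomial (suc i) j ≡ (x - + 1) * monomial i j
  monomial-sucˡ i j = ℤₚ.*-assoc (x - + 1) ((x - + 1) ^ i) ((y - + 1) ^ j)

  monomial-sucʳ : ∀ i j → monomial i (suc j) ≡ (y - + 1) * monomial i j
  monomial-sucʳ i j = ℤ*.x∙yz≈y∙xz ((x - + 1) ^ i) (y - + 1) ((y - + 1) ^ j)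

  tutteTerm : ∀ {m} → LGraph m → Subgraph m → ℤ
  tutteTerm H S = monomial (cc (restrict H S) ∸ cc H) (cycl H S)

  activityTerm : ∀ {m} → LGraph m → BTree m → Subgraph m → ℤ
  activityTerm H Δ T = if isSpanningTree H T then (x ^ numIntActive H Δ T) * (y ^ numExtActive H Δ T) else + 0

  when : Bool → ℤ → ℤ
  when b X = if b then X else + 0

  -- both sides of the theorem for the graph formed by the edges present in H
  tutteOf : ∀ {m} → LGraph m → ℤ
  tutteOf H = sumSubsets λ S → when (S ⊆ᵇ pres H) (tutteTerm H S)

  activityOf : ∀ {m} → LGraph m → BTree m → ℤ
  activityOf H Δ = sumSubsets λ T → when (T ⊆ᵇ pres H) (activityTerm H Δ T)

  activityTerm-≡ : ∀ {m} (H₁ H₂ : LGraph m) Δ₁ Δ₂ T₁ T₂ →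
    isSpanningTree H₁ T₁ ≡ isSpanningTree H₂ T₂ →
    numIntActive H₁ Δ₁ T₁ ≡ numIntActive H₂ Δ₂ T₂ → numExtActive H₁ Δ₁ T₁ ≡ numExtActive H₂ Δ₂ T₂ →
    activityTerm H₁ Δ₁ T₁ ≡ activityTerm H₂ Δ₂ T₂
  activityTerm-≡ _ _ _ _ _ _ a b c rewrite a | b | c = refl

  activityTerm-nonTree : ∀ {m} {H : LGraph m} {Δ T} → isSpanningTree H T ≡ false → activityTerm H Δ T ≡ + 0
  activityTerm-nonTree h rewrite h = refl

  tutteSummand-ext : ∀ {m} (H : LGraph m) → Extensional (λ S → when (S ⊆ᵇ pres H) (tutteTerm H S))
  tutteSummand-ext H S S' h = cong₂ when (⊆ᵇ-cong h)
    (cong₂ (λ a b → monomial (a ∸ cc H) b) (cc-restrict-cong H S S' h) (cycl-cong H S S' h))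

  activitySummand-ext : ∀ {m} (H : LGraph m) Δ → Extensional (λ T → when (T ⊆ᵇ pres H) (activityTerm H Δ T))
  activitySummand-ext H Δ S S' h = cong₂ when (⊆ᵇ-cong h)
    (activityTerm-≡ H H Δ Δ S S' (isSpanningTree-cong H S S' h) (numIntActive-cong H Δ S S' h) (numExtActive-cong H Δ S S' h))

  when-* : ∀ b c X → when b (c * X) ≡ c * when b X
  when-* true  c X = refl
  when-* false c X = sym (ℤₚ.*-zeroʳ c)

  -- Without edges, the only subgraph is the empty one, a spanning tree of the single vertex.
  tutteOf≡activityOf-leaf : ∀ {m} (H : LGraph m) → cc H ≡ 1 → IsDecisionTreeFor (pres H) leaf →
    tutteOf H ≡ activityOf H leaf
  tutteOf≡activityOf-leaf H c1 no-edges = sumSubsets-cong summand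
    where
      summand : ∀ S → when (S ⊆ᵇ pres H) (tutteTerm H S) ≡ when (S ⊆ᵇ pres H) (activityTerm H leaf S)
      summand S with S ⊆ᵇ pres H in S⊆H
      ... | false = refl
      ... | true  = trans (cong₂ monomial (cong₂ _∸_ cc-S c1) cycl-S) (sym activity-S)
        where
          S-empty : ∀ g → S g ≡ false
          S-empty g = ≢true⇒false λ sg → not-¬ (no-edges g) (⊆ᵇ⇒ {S = S} S⊆H g sg)
          cc-S : cc (restrict H S) ≡ 1
          cc-S = trans (EdgeSets.cc-cong (ends H) (λ g → trans (cong (_∧ S g) (no-edges g)) (sym (no-edges g)))) c1
          cycl-S : cycl H S ≡ 0
          cycl-S = cong₂ _∸_ (cong₂ _+ℕ_ cc-S (countF-false S S-empty))
                             (trans (sym (EdgeSets.cc-edgeless (ends H) (pres H) no-edges)) c1)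
          activity-S : activityTerm H leaf S ≡ + 1
          activity-S rewrite cong₂ (λ a b → (a ℕ.≡ᵇ 1) ∧ (b ℕ.≡ᵇ 0)) cc-S cycl-S
            | countF-false (λ g → S g ∧ false) (λ g → Boolₚ.∧-zeroʳ (S g))
            | countF-false (λ g → not (S g) ∧ false) (λ g → Boolₚ.∧-zeroʳ (not (S g))) = refl

  module AtRoot {m k} (ends' : Fin m → Fin (suc k) × Fin (suc k)) (pr : Fin m → Bool) (e : Fin m)
    (l r : BTree m) (dt : IsDecisionTreeFor pr (node e l r)) where
    H He : LGraph m
    H  = mkG (suc k) ends' pr
    He = delete e H
    open Without pr e public
    open ComponentsAt ends' pr e public hiding (H)
    open AssignAt ends' pr e l r public

    pe : pr e ≡ true
    pe = proj₁ dt
    dl : IsDecisionTreeFor P₋ l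
    dl = proj₁ (proj₂ dt)
    dr : IsDecisionTreeFor P₋ r
    dr = proj₂ (proj₂ dt)
    e∉l : ¬ InTree e l
    e∉l = root∉subtree e l dl
    e∉r : ¬ InTree e r
    e∉r = root∉subtree e r dr

    tH tHe aH aHe : Subgraph m → ℤ
    tH  S = when (S ⊆ᵇ pr) (tutteTerm H S)
    tHe S = when (S ⊆ᵇ P₋) (tutteTerm He S)
    aH  T = when (T ⊆ᵇ pr) (activityTerm H (node e l r) T)
    aHe T = when (T ⊆ᵇ P₋) (activityTerm He l T)

    tutte∌e-nonIsthmus : cc He ≡ cc H → ∀ S → unless (S e) (tH S) ≡ tHe S
    tutte∌e-nonIsthmus cc-He S with S e in se
    ... | true rewrite ⊆ᵇ-without-∈ {S = S} se = refl
    ... | false rewrite ⊆ᵇ-without-∉ {S = S} se = cong (when (S ⊆ᵇ P₋))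
      (cong₂ (λ a b → monomial (a ∸ b) ((a +ℕ size S) ∸ suc k)) (cc-restrict-delete S se) (sym cc-He))

    isSpanningTree-delete : ∀ T → T e ≡ false → isSpanningTree H T ≡ isSpanningTree He T
    isSpanningTree-delete T se =
      cong (λ c → (c ℕ.≡ᵇ 1) ∧ (((c +ℕ size T) ∸ suc k) ℕ.≡ᵇ 0)) (cc-restrict-delete T se)

    module LoopCase (u≡v : proj₁ (ends' e) ≡ proj₂ (ends' e)) where
      open Loop u≡v public

      cycl-add : ∀ S → S e ≡ false → (∀ g → S g ≡ true → P₋ g ≡ true) → cycl H (add S e) ≡ suc (cycl He S)
      cycl-add S se S⊆ = trans
        (cong₂ (λ a b → (a +ℕ b) ∸ suc k) (cc-restrict (add S e) S (λ g g≟e → sym (add-off S g g≟e))) (size-add se))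
        (trans (cong (_∸ suc k) (ℕₚ.+-suc _ (size S))) (ℕₚ.+-∸-assoc 1 (vertices≤cc+size ends' P₋ S S⊆)))

      tutte∋e : ∀ S → unless (S e) (tH (add S e)) ≡ (y - + 1) * tHe S
      tutte∋e S with S e in se
      ... | true rewrite ⊆ᵇ-without-∈ {S = S} se = sym (ℤₚ.*-zeroʳ (y - + 1))
      ... | false rewrite add-⊆ᵇ pe {S = S} se with S ⊆ᵇ P₋ in S⊆
      ...   | false = sym (ℤₚ.*-zeroʳ (y - + 1))
      ...   | true  = trans
        (cong₂ monomial (cong₂ _∸_ (cc-restrict (add S e) S (λ g g≟e → sym (add-off S g g≟e))) cc-delete)
                        (cycl-add S se (⊆ᵇ⇒ {S = S} S⊆)))
        (monomial-sucʳ (cc (restrict He S) ∸ cc He) (cycl He S))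

      activity∌e : ∀ T → unless (T e) (aH T) ≡ y * aHe T
      activity∌e T with T e in se
      ... | true rewrite ⊆ᵇ-without-∈ {S = T} se = sym (ℤₚ.*-zeroʳ y)
      ... | false rewrite ⊆ᵇ-without-∉ {S = T} se =
        trans (cong (when (T ⊆ᵇ P₋)) term) (when-* (T ⊆ᵇ P₋) y (activityTerm He l T))
        where
          int : numIntActive H (node e l r) T ≡ numIntActive He l T
          int = trans (numIntActive-node H He e l r l T L (assign-loop T u≡v) e∉l)
                      (cong (λ b → ind (b ∧ true) +ℕ numIntActive He l T) se)
          ext : numExtActive H (node e l r) T ≡ suc (numExtActive He l T)
          ext = trans (numExtActive-node H He e l r l T L (assign-loop T u≡v) e∉l)
                      (cong (λ b → ind (not b ∧ true) +ℕ numExtActive He l T) se)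
          term : activityTerm H (node e l r) T ≡ y * activityTerm He l T
          term rewrite isSpanningTree-delete T se | int | ext with isSpanningTree He T
          ... | true  = ℤ*.x∙yz≈y∙xz (x ^ numIntActive He l T) y (y ^ numExtActive He l T)
          ... | false = sym (ℤₚ.*-zeroʳ y)

      activity∋e : ∀ T → unless (T e) (aH (add T e)) ≡ + 0
      activity∋e T with T e in se
      ... | true = refl
      ... | false with add T e ⊆ᵇ pr in T+e⊆
      ...   | false = refl
      ...   | true  = activityTerm-nonTree {H = H} {Δ = node e l r} {T = add T e}
        (¬isSpanningTree-cycl H (add T e) (subst (0 <_) (sym (cycl-add T se T⊆)) (s≤s z≤n)))
        where
          T⊆ : ∀ g → T g ≡ true → P₋ g ≡ true
          T⊆ g tg = ∧-true (⊆ᵇ⇒ {S = add T e} T+e⊆ g (∨-trueˡ (eqF g e) tg))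
            (cong not (≢⇒eqF λ eq → not-¬ se (subst (λ z → T z ≡ true) eq tg)))

      tutte-loop : tutteOf H ≡ y * tutteOf He
      tutte-loop = begin
          tutteOf H
        ≡⟨ sumSubsets-split e tH (tutteSummand-ext H) ⟩
          sumSubsets (λ S → unless (S e) (tH S)) +ℤ sumSubsets (λ S → unless (S e) (tH (add S e)))
        ≡⟨ cong₂ _+ℤ_ (sumSubsets-cong (tutte∌e-nonIsthmus (sym cc-delete)))
                      (trans (sumSubsets-cong tutte∋e) (sumSubsets-* (y - + 1) tHe)) ⟩
          tutteOf He +ℤ (y - + 1) * tutteOf He
        ≡⟨ t+[a-1]t≡at y (tutteOf He) ⟩
          y * tutteOf He
        ∎
        where open ≡-Reasoning

      activity-loop : activityOf H (node e l r) ≡ y * activityOf He l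
      activity-loop = begin
          activityOf H (node e l r)
        ≡⟨ sumSubsets-split e aH (activitySummand-ext H (node e l r)) ⟩
          sumSubsets (λ T → unless (T e) (aH T)) +ℤ sumSubsets (λ T → unless (T e) (aH (add T e)))
        ≡⟨ cong₂ _+ℤ_ (trans (sumSubsets-cong activity∌e) (sumSubsets-* y aHe))
                      (trans (sumSubsets-cong activity∋e) (sumSubsets-zero {m})) ⟩
          y * activityOf He l +ℤ + 0
        ≡⟨ ℤₚ.+-identityʳ _ ⟩
          y * activityOf He l
        ∎
        where open ≡-Reasoning

    module NonLoopCase {u≢v : proj₁ (ends' e) ≢ proj₂ (ends' e)}
      (e-nonloop : (proj₁ (ends' e) ≟ proj₂ (ends' e)) ≡ no u≢v) where
      open NonLoop u≢v public

      tHc aHc : Subgraph m → ℤ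
      tHc S = when (S ⊆ᵇ P₋) (tutteTerm Hc S)
      aHc T = when (T ⊆ᵇ P₋) (activityTerm Hc r T)

      cc-restrict-add : ∀ S → cc (restrict H (add S e)) ≡ cc (restrict Hc S)
      cc-restrict-add S =
        Restricted.cc-restrict-contract (add S e) S (λ g g≟e → sym (add-off S g g≟e)) pe (add-self S)

      cycl-add : ∀ S → S e ≡ false → cycl H (add S e) ≡ cycl Hc S
      cycl-add S se = trans (cong₂ (λ a b → (a +ℕ b) ∸ suc k) (cc-restrict-add S) (size-add se))
                            (cong (_∸ suc k) (ℕₚ.+-suc _ (size S)))

      tutte∋e : ∀ S → unless (S e) (tH (add S e)) ≡ tHc S
      tutte∋e S with S e in se
      ... | true rewrite ⊆ᵇ-without-∈ {S = S} se = refl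
      ... | false rewrite add-⊆ᵇ pe {S = S} se = cong (when (S ⊆ᵇ P₋))
        (cong₂ monomial (cong₂ _∸_ (cc-restrict-add S) (cc-contract pe)) (cycl-add S se))

      isSpanningTree-add : ∀ T → T e ≡ false → isSpanningTree H (add T e) ≡ isSpanningTree Hc T
      isSpanningTree-add T se = cong₂ (λ a b → (a ℕ.≡ᵇ 1) ∧ (b ℕ.≡ᵇ 0)) (cc-restrict-add T) (cycl-add T se)

      -- e does not label r, so the activities in Hc do not see whether e ∈ T
      countActive-add : ∀ (side : Bool → Bool) T →
        countF (λ g → side (add T e g) ∧ isActive Hc r (add T e) g) ≡ countF (λ g → side (T g) ∧ isActive Hc r T g)
      countActive-add side T = countF-cong pointwise
        where
          pointwise : ∀ g → side (add T e g) ∧ isActive Hc r (add T e) g ≡ side (T g) ∧ isActive Hc r T g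
          pointwise g rewrite isActive-local Hc r (add T e) T
            (λ g′ i → add-off T g′ (≢⇒eqF λ eq → e∉r (subst (λ z → InTree z r) eq i))) g with eqF g e in g≟e
          ... | true rewrite eqF⇒≡ g≟e | isActive-∉ Hc r T e e∉r =
            trans (Boolₚ.∧-zeroʳ _) (sym (Boolₚ.∧-zeroʳ _))
          ... | false rewrite Boolₚ.∨-identityʳ (T g) = refl

      numIntActive-add : ∀ T → numIntActive Hc r (add T e) ≡ numIntActive Hc r T
      numIntActive-add T = countActive-add (λ b → b) T

      numExtActive-add : ∀ T → numExtActive Hc r (add T e) ≡ numExtActive Hc r T
      numExtActive-add T = countActive-add not T

      module StandardCase (std : (cc H <ᵇ cc He) ≡ false) where
        activity∌e : ∀ T → unless (T e) (aH T) ≡ aHe T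
        activity∌e T with T e in se
        ... | true rewrite ⊆ᵇ-without-∈ {S = T} se = refl
        ... | false rewrite ⊆ᵇ-without-∉ {S = T} se = cong (when (T ⊆ᵇ P₋))
          (activityTerm-≡ H He (node e l r) l T T (isSpanningTree-delete T se) int ext)
          where
            int : numIntActive H (node e l r) T ≡ numIntActive He l T
            int = trans (numIntActive-node H He e l r l T Se (assign-standard∉ T e-nonloop std se) e∉l)
                        (cong (λ b → ind (b ∧ false) +ℕ numIntActive He l T) se)
            ext : numExtActive H (node e l r) T ≡ numExtActive He l T
            ext = trans (numExtActive-node H He e l r l T Se (assign-standard∉ T e-nonloop std se) e∉l)
                        (cong (λ b → ind (not b ∧ false) +ℕ numExtActive He l T) se)

        activity∋e : ∀ T → unless (T e) (aH (add T e)) ≡ aHc T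
        activity∋e T with T e in se
        ... | true rewrite ⊆ᵇ-without-∈ {S = T} se = refl
        ... | false rewrite add-⊆ᵇ pe {S = T} se = cong (when (T ⊆ᵇ P₋))
          (activityTerm-≡ H Hc (node e l r) r (add T e) T (isSpanningTree-add T se) int ext)
          where
            assigned : assign (add T e) H (node e l r) ≡ (e , Si) ∷ assign (add T e) Hc r
            assigned = assign-standard∈ (add T e) e-nonloop std (add-self T)
            int : numIntActive H (node e l r) (add T e) ≡ numIntActive Hc r T
            int = trans (numIntActive-node H Hc e l r r (add T e) Si assigned e∉r)
              (trans (cong (λ b → ind (b ∧ false) +ℕ numIntActive Hc r (add T e)) (add-self T)) (numIntActive-add T))
            ext : numExtActive H (node e l r) (add T e) ≡ numExtActive Hc r T
            ext = trans (numExtActive-node H Hc e l r r (add T e) Si assigned e∉r)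
              (trans (cong (λ b → ind (not b ∧ false) +ℕ numExtActive Hc r (add T e)) (add-self T)) (numExtActive-add T))

        tutte-standard : tutteOf H ≡ tutteOf He +ℤ tutteOf Hc
        tutte-standard = trans (sumSubsets-split e tH (tutteSummand-ext H))
          (cong₂ _+ℤ_ (sumSubsets-cong (tutte∌e-nonIsthmus (cc-delete-nonIsthmus std))) (sumSubsets-cong tutte∋e))

        activity-standard : activityOf H (node e l r) ≡ activityOf He l +ℤ activityOf Hc r
        activity-standard = trans (sumSubsets-split e aH (activitySummand-ext H (node e l r)))
          (cong₂ _+ℤ_ (sumSubsets-cong activity∌e) (sumSubsets-cong activity∋e))

      module IsthmusCase (ist : (cc H <ᵇ cc He) ≡ true) (c1 : cc H ≡ 1) where
        cc-restrict-∌e : ∀ S → S e ≡ false → (∀ g → S g ≡ true → pr g ≡ true) →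
          cc (restrict H S) ≡ suc (cc (restrict Hc S))
        cc-restrict-∌e S se S⊆ = Restricted.cc-restrict-contract-separated S S (λ _ _ → refl)
          (isthmus-separates ist S S⊆ se)

        tutte∌e : ∀ S → unless (S e) (tH S) ≡ (x - + 1) * tHc S
        tutte∌e S with S e in se
        ... | true rewrite ⊆ᵇ-without-∈ {S = S} se = sym (ℤₚ.*-zeroʳ (x - + 1))
        ... | false rewrite ⊆ᵇ-without-∉ {S = S} se with S ⊆ᵇ P₋ in S⊆
        ...   | false = sym (ℤₚ.*-zeroʳ (x - + 1))
        ...   | true  = trans (cong₂ monomial excess (cong (λ a → (a +ℕ size S) ∸ suc k) cc-S))
                              (monomial-sucˡ (cc (restrict Hc S) ∸ cc Hc) (cycl Hc S))
          where
            cc-S : cc (restrict H S) ≡ suc (cc (restrict Hc S))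
            cc-S = cc-restrict-∌e S se λ g sg → ∧-trueˡ (⊆ᵇ⇒ {S = S} S⊆ g sg)
            excess : cc (restrict H S) ∸ cc H ≡ suc (cc (restrict Hc S) ∸ cc Hc)
            excess = trans (cong₂ _∸_ cc-S (cc-contract pe)) (ℕₚ.+-∸-assoc 1 (cc≤cc-restrict Hc S))

        -- a spanning tree must contain every isthmus
        activity∌e : ∀ T → unless (T e) (aH T) ≡ + 0
        activity∌e T with T e in se
        ... | true = refl
        ... | false with T ⊆ᵇ pr in T⊆
        ...   | false = refl
        ...   | true  = activityTerm-nonTree {H = H} {Δ = node e l r} {T = T} (¬isSpanningTree-cc H T
          (subst (1 <_) (sym (cc-restrict-∌e T se (⊆ᵇ⇒ {S = T} T⊆)))
                 (s≤s (subst (_≤ cc (restrict Hc T)) (trans (sym (cc-contract pe)) c1) (cc≤cc-restrict Hc T)))))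

        activity∋e : ∀ T → unless (T e) (aH (add T e)) ≡ x * aHc T
        activity∋e T with T e in se
        ... | true rewrite ⊆ᵇ-without-∈ {S = T} se = sym (ℤₚ.*-zeroʳ x)
        ... | false rewrite add-⊆ᵇ pe {S = T} se =
          trans (cong (when (T ⊆ᵇ P₋)) term) (when-* (T ⊆ᵇ P₋) x (activityTerm Hc r T))
          where
            assigned : assign (add T e) H (node e l r) ≡ (e , I) ∷ assign (add T e) Hc r
            assigned = assign-isthmus (add T e) e-nonloop ist
            int : numIntActive H (node e l r) (add T e) ≡ suc (numIntActive Hc r T)
            int = trans (numIntActive-node H Hc e l r r (add T e) I assigned e∉r)
              (trans (cong (λ b → ind (b ∧ true) +ℕ numIntActive Hc r (add T e)) (add-self T))
                     (cong suc (numIntActive-add T)))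
            ext : numExtActive H (node e l r) (add T e) ≡ numExtActive Hc r T
            ext = trans (numExtActive-node H Hc e l r r (add T e) I assigned e∉r)
              (trans (cong (λ b → ind (not b ∧ true) +ℕ numExtActive Hc r (add T e)) (add-self T)) (numExtActive-add T))
            term : activityTerm H (node e l r) (add T e) ≡ x * activityTerm Hc r T
            term rewrite isSpanningTree-add T se | int | ext with isSpanningTree Hc T
            ... | true  = ℤₚ.*-assoc x (x ^ numIntActive Hc r T) (y ^ numExtActive Hc r T)
            ... | false = sym (ℤₚ.*-zeroʳ x)

        tutte-isthmus : tutteOf H ≡ x * tutteOf Hc
        tutte-isthmus = begin
            tutteOf H
          ≡⟨ sumSubsets-split e tH (tutteSummand-ext H) ⟩
            sumSubsets (λ S → unless (S e) (tH S)) +ℤ sumSubsets (λ S → unless (S e) (tH (add S e)))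
          ≡⟨ cong₂ _+ℤ_ (trans (sumSubsets-cong tutte∌e) (sumSubsets-* (x - + 1) tHc)) (sumSubsets-cong tutte∋e) ⟩
            (x - + 1) * tutteOf Hc +ℤ tutteOf Hc
          ≡⟨ [a-1]t+t≡at x (tutteOf Hc) ⟩
            x * tutteOf Hc
          ∎
          where open ≡-Reasoning

        activity-isthmus : activityOf H (node e l r) ≡ x * activityOf Hc r
        activity-isthmus = begin
            activityOf H (node e l r)
          ≡⟨ sumSubsets-split e aH (activitySummand-ext H (node e l r)) ⟩
            sumSubsets (λ T → unless (T e) (aH T)) +ℤ sumSubsets (λ T → unless (T e) (aH (add T e)))
          ≡⟨ cong₂ _+ℤ_ (trans (sumSubsets-cong activity∌e) (sumSubsets-zero {m}))
                        (trans (sumSubsets-cong activity∋e) (sumSubsets-* x aHc)) ⟩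
            + 0 +ℤ x * activityOf Hc r
          ≡⟨ ℤₚ.+-identityˡ _ ⟩
            x * activityOf Hc r
          ∎
          where open ≡-Reasoning

  tutteOf≡activityOf : ∀ {m} (Δ : BTree m) (H : LGraph m) → cc H ≡ 1 → IsDecisionTreeFor (pres H) Δ →
    tutteOf H ≡ activityOf H Δ
  tutteOf≡activityOf leaf H c1 dt = tutteOf≡activityOf-leaf H c1 dt
  tutteOf≡activityOf (node e l r) (mkG zero ends' pr) c1 dt with proj₁ (ends' e)
  ... | ()
  tutteOf≡activityOf (node e l r) (mkG (suc k) ends' pr) c1 dt = by-root (proj₁ (ends' e) ≟ proj₂ (ends' e)) refl
    where
      open AtRoot ends' pr e l r dt
      open ≡-Reasoning
      -- a with on the test would also abstract it inside assign in the goal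
      by-root : (d : Dec (proj₁ (ends' e) ≡ proj₂ (ends' e))) → (proj₁ (ends' e) ≟ proj₂ (ends' e)) ≡ d →
        tutteOf H ≡ activityOf H (node e l r)
      by-root (yes u≡v) _ = begin
          tutteOf H                   ≡⟨ tutte-loop ⟩
          y * tutteOf He              ≡⟨ cong (y *_) (tutteOf≡activityOf l He (trans (sym cc-delete) c1) dl) ⟩
          y * activityOf He l         ≡⟨ sym activity-loop ⟩
          activityOf H (node e l r)   ∎
        where open LoopCase u≡v
      by-root (no u≢v) e-nonloop = by-isthmus (cc H <ᵇ cc He) refl
        where
          open NonLoopCase e-nonloop
          cc-Hc : cc Hc ≡ 1
          cc-Hc = trans (sym (cc-contract pe)) c1
          by-isthmus : (b : Bool) → (cc H <ᵇ cc He) ≡ b → tutteOf H ≡ activityOf H (node e l r)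
          by-isthmus true ist = begin
              tutteOf H                 ≡⟨ tutte-isthmus ⟩
              x * tutteOf Hc            ≡⟨ cong (x *_) (tutteOf≡activityOf r Hc cc-Hc dr) ⟩
              x * activityOf Hc r       ≡⟨ sym activity-isthmus ⟩
              activityOf H (node e l r) ∎
            where open IsthmusCase ist c1
          by-isthmus false std = begin
              tutteOf H                          ≡⟨ tutte-standard ⟩
              tutteOf He +ℤ tutteOf Hc           ≡⟨ cong₂ _+ℤ_
                                                      (tutteOf≡activityOf l He (trans (cc-delete-nonIsthmus std) c1) dl)
                                                      (tutteOf≡activityOf r Hc cc-Hc dr) ⟩
              activityOf He l +ℤ activityOf Hc r ≡⟨ sym activity-standard ⟩
              activityOf H (node e l r)          ∎
            where open StandardCase std

mainTheorem11 : (n m : ℕ) (ends : Fin (suc m) → Fin n × Fin n)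
    → cc (graph n (suc m) ends) ≡ 1
    → (Δ : BTree (suc m)) → IsDecisionTree Δ
    → (x y : ℤ)
    → tutte (graph n (suc m) ends) x y ≡ activitySum (graph n (suc m) ends) Δ x y
mainTheorem11 n m ends c1 Δ isDecisionTree x y = begin
    tutte G x y
  ≡⟨ sumSubsets-cong (λ S → cong (λ b → when b (tutteTerm G S)) (sym (⊆ᵇ-all S))) ⟩
    tutteOf G
  ≡⟨ tutteOf≡activityOf Δ G c1 (IsDecisionTree⇒IsDecisionTreeFor Δ isDecisionTree) ⟩
    activityOf G Δ
  ≡⟨ sumSubsets-cong (λ T → cong (λ b → when b (activityTerm G Δ T)) (⊆ᵇ-all T)) ⟩
    activitySum G Δ x y
  ∎
  where
    open Expansions x y
    open ≡-Reasoning
    G : LGraph (suc m)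
    G = graph n (suc m) ends
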